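{- Define constants $\beta_g$, $g\ge1$, by $\beta_1=\tfrac12$ and, for $g\ge2$, $$\beta_g=\frac12\sum_{\ell=1}^{g-1}\beta_\ell\beta_{g-\ell}+\frac12\sum_{\substack{k_1,\dots,k_{g-1}\ge0\\ k_1+2k_2+\dots+(g-1)k_{g-1}=g-1}}\frac{(k_1+\dots+k_{g-1})!}{k_1!\cdots k_{g-1}!}\Big[\Big(\sum_{\ell=1}^{g-1}k_\ell\Big)+1\Big]\prod_{\ell=1}^{g-1}\beta_\ell^{k_\ell}.$$ Then for every $g\ge1$, $2^{2g-1}\beta_g=C_{2g-1}$, where $C_m=\frac{1}{m+1}\binom{2m}{m}$ is the $m$th Catalan number. -}

module Defs where

open import Data.Nat as ℕ using (ℕ; zero; suc; _∸_; _!; NonZero; _≡ᵇ_)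
open import Data.Nat.Properties using (m*n≢0; _≟_; _!≢0)
open import Data.Nat.Combinatorics using (_C_)
open import Data.Integer using (+_)
open import Data.Rational using (ℚ; 0ℚ; 1ℚ; ½; _+_; _*_; _/_)
open import Data.List using (List; []; _∷_; map; concatMap; filter; upTo; foldr)
open import Data.Vec using (Vec; []; _∷_)
open import Data.Bool using (if_then_else_)

ℕtoℚ : ℕ → ℚ
ℕtoℚ n = + n / 1

_^ℚ_ : ℚ → ℕ → ℚ
q ^ℚ zero  = 1ℚ
q ^ℚ suc n = q * (q ^ℚ n)

sumℚ : List ℚ → ℚ
sumℚ = foldr _+_ 0ℚ

box : (m b : ℕ) → List (Vec ℕ m)
box zero    b = [] ∷ []
box (suc m) b = concatMap (λ k → map (k ∷_) (box m b)) (upTo b)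

weighted : ℕ → {m : ℕ} → Vec ℕ m → ℕ
weighted ℓ []       = 0
weighted ℓ (k ∷ ks) = ℓ ℕ.* k ℕ.+ weighted (suc ℓ) ks

total : {m : ℕ} → Vec ℕ m → ℕ
total []       = 0
total (k ∷ ks) = k ℕ.+ total ks

prodFact : {m : ℕ} → Vec ℕ m → ℕ
prodFact []       = 1
prodFact (k ∷ ks) = k ! ℕ.* prodFact ks

prodFact≢0 : {m : ℕ} (ks : Vec ℕ m) → NonZero (prodFact ks)
prodFact≢0 []       = _
prodFact≢0 (k ∷ ks) = m*n≢0 (k !) (prodFact ks) {{k !≢0}} {{prodFact≢0 ks}}

multinomial : {m : ℕ} → Vec ℕ m → ℚ
multinomial ks = (+ (total ks !) / prodFact ks) {{prodFact≢0 ks}}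

prodPow : (ℕ → ℚ) → ℕ → {m : ℕ} → Vec ℕ m → ℚ
prodPow b ℓ []       = 1ℚ
prodPow b ℓ (k ∷ ks) = (b ℓ ^ℚ k) * prodPow b (suc ℓ) ks

-- tuples (k₁,…,k_{g-1}) of naturals with k₁ + 2k₂ + … + (g-1)k_{g-1} = g-1
-- (each such k_ℓ is automatically ≤ g-1, so enumerating the box {0,…,g-1}^{g-1} is exhaustive)
tuples : (g : ℕ) → List (Vec ℕ (g ∸ 1))
tuples g = filter (λ ks → weighted 1 ks ≟ (g ∸ 1)) (box (g ∸ 1) g)

-- right-hand side of the recursion for β_g, given the values b ℓ for ℓ < g
step : (g : ℕ) → (ℕ → ℚ) → ℚ
step g b =
  ½ * sumℚ (map (λ ℓ → b ℓ * b (g ∸ ℓ)) (map suc (upTo (g ∸ 1))))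
  + ½ * sumℚ (map (λ ks → multinomial ks * (ℕtoℚ (total ks) + 1ℚ) * prodPow b 1 ks) (tuples g))

-- βUpTo n ℓ = β_ℓ for 1 ≤ ℓ ≤ n (junk value 0 elsewhere)
βUpTo : ℕ → (ℕ → ℚ)
βUpTo zero          = λ _ → 0ℚ
βUpTo (suc zero)    = λ ℓ → if ℓ ≡ᵇ 1 then ½ else 0ℚ
βUpTo (suc (suc n)) = λ ℓ → if ℓ ≡ᵇ suc (suc n) then step (suc (suc n)) (βUpTo (suc n)) else βUpTo (suc n) ℓ

β : ℕ → ℚ
β g = βUpTo g g

catalan : ℕ → ℚ
catalan m = + ((2 ℕ.* m) C m) / suc m

-- Let B = Σ β_g xᵍ. By the multinomial theorem the sum over tuples (k_ℓ) is the coefficient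
-- of x^(g-1) in Σₙ (n+1) Bⁿ = (1 - B)⁻², so the recursion says 2B - B² = x (1 - B)⁻², i.e.
-- U = 1 - B satisfies U²(1 - U²) = x. Differentiating this twice with θ = x d/dx shows that U
-- is annihilated by the hypergeometric operator 4(1 - 4x)θ² - 2θ + x, whose coefficients give
-- the first-order recurrence (h+2)(4h+6) β_{h+2} = (4h+3)(4h+5) β_{h+1}. By the ratio
-- (m+2) C_{m+1} = 2(2m+1) C_m, the numbers C_{2h+1} / 2^(2h+1) satisfy the same recurrence.
module Submission where

module BetaCatalan where

  open import Defs
  open import Level using (0ℓ)
  open import Function using (_∘_)
  open import Data.Empty using (⊥-elim)
  open import Data.Product using (_,_)
  open import Data.Bool using (true; false; if_then_else_)
  open import Data.Maybe using (Maybe; just; nothing)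
  open import Data.Nat as ℕ using (ℕ; zero; suc; _∸_; _≤_; _<_; z≤n; s≤s; _!; _≡ᵇ_; NonZero)
  import Data.Nat.Properties as ℕₚ
  open import Data.Nat.Induction using (<-rec)
  open import Data.Nat.Combinatorics using (_C_; nCk≡n!/k![n-k]!; k![n∸k]!∣n!)
  open import Data.Nat.DivMod using (m*[n/m]≡n)
  import Data.Nat.Coprimality as Coprimality
  import Data.Integer as ℤ
  import Data.Integer.Properties as ℤₚ
  open import Data.Rational as ℚ using (ℚ; 0ℚ; 1ℚ; ½; _+_; _*_; -_; _/_; mkℚ; toℚᵘ)
  open import Data.Rational.Properties
  import Data.Rational.Unnormalised as ℚᵘ
  import Data.Rational.Unnormalised.Properties as ℚᵘₚ
  open import Data.Fin using (Fin; toℕ) renaming (zero to fzero; suc to fsuc)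
  open import Data.List using (List; []; _∷_; _++_; map; concatMap; applyUpTo; upTo; filter)
  open import Data.List.Properties using (map-∘)
  open import Data.Vec using (Vec; []; _∷_)
  open import Relation.Binary.PropositionalEquality
  import Relation.Binary.Reasoning.Setoid as SetoidReasoning
  open import Relation.Nullary using (¬_; Dec; yes; no; does)
  open import Relation.Nullary.Decidable using (dec⇒maybe; dec-true; dec-false)
  open import Relation.Unary using (Pred; Decidable)
  open import Algebra.Bundles using (CommutativeRing)
  import Algebra.Properties.CommutativeSemiring.Binomial as Binomial
  import Algebra.Definitions.RawMonoid as RawMonoid
  import Algebra.Solver.Ring as RingSolver
  import Algebra.Solver.Ring.AlmostCommutativeRing as RingSolverACR
  open import Tactic.RingSolver using (solve-∀)
  import Tactic.RingSolver.Core.AlmostCommutativeRing as ReflectiveACR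
  open import Data.Nat.Tactic.RingSolver using () renaming (solve-∀ to ℕ-solve-∀)

  ℚ-ring : ReflectiveACR.AlmostCommutativeRing 0ℓ 0ℓ
  ℚ-ring = ReflectiveACR.fromCommutativeRing +-*-commutativeRing (λ x → dec⇒maybe (0ℚ ≟ x))

  ℕtoℚ≡mkℚ : ∀ n → ℕtoℚ n ≡ mkℚ (ℤ.+ n) 0 (Coprimality.sym (Coprimality.1-coprimeTo n))
  ℕtoℚ≡mkℚ n = normalize-coprime (Coprimality.sym (Coprimality.1-coprimeTo n))

  ℕtoℚ-homo-+ : ∀ m n → ℕtoℚ (m ℕ.+ n) ≡ ℕtoℚ m + ℕtoℚ n
  ℕtoℚ-homo-+ m n rewrite ℕtoℚ≡mkℚ m | ℕtoℚ≡mkℚ n =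
    /-cong (trans (ℤₚ.pos-+ m n) (sym (cong₂ ℤ._+_ (ℤₚ.*-identityʳ (ℤ.+ m)) (ℤₚ.*-identityʳ (ℤ.+ n))))) refl

  ℕtoℚ-homo-* : ∀ m n → ℕtoℚ (m ℕ.* n) ≡ ℕtoℚ m * ℕtoℚ n
  ℕtoℚ-homo-* m n rewrite ℕtoℚ≡mkℚ m | ℕtoℚ≡mkℚ n = /-cong (ℤₚ.pos-* m n) refl

  ℕtoℚ-suc : ∀ n → ℕtoℚ (suc n) ≡ 1ℚ + ℕtoℚ n
  ℕtoℚ-suc = ℕtoℚ-homo-+ 1

  ℕtoℚ-nonZero : ∀ n .{{_ : NonZero n}} → ℕtoℚ n ≢ 0ℚ
  ℕtoℚ-nonZero (suc n) eq with trans (sym (ℕtoℚ≡mkℚ (suc n))) eq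
  ... | ()

  /-*-ℕtoℚ : ∀ m n .{{_ : NonZero n}} → (ℤ.+ m / n) * ℕtoℚ n ≡ ℕtoℚ m
  /-*-ℕtoℚ m n@(suc n-1) = toℚᵘ-injective (begin-equality
      toℚᵘ ((ℤ.+ m / n) * ℕtoℚ n)             ≃⟨ toℚᵘ-homo-* (ℤ.+ m / n) (ℕtoℚ n) ⟩
      toℚᵘ (ℤ.+ m / n) ℚᵘ.* toℚᵘ (ℕtoℚ n)      ≃⟨ ℚᵘₚ.*-cong (toℚᵘ-fromℚᵘ (ℚᵘ.mkℚᵘ (ℤ.+ m) n-1)) (toℚᵘ-cong (ℕtoℚ≡mkℚ n)) ⟩
      ℚᵘ.mkℚᵘ (ℤ.+ m) n-1 ℚᵘ.* ℚᵘ.mkℚᵘ (ℤ.+ n) 0 ≃⟨ ℚᵘ.*≡* (cancel-denominator m n-1) ⟩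
      ℚᵘ.mkℚᵘ (ℤ.+ m) 0                        ≃⟨ toℚᵘ-cong (ℕtoℚ≡mkℚ m) ⟨
      toℚᵘ (ℕtoℚ m)                          ∎)
    where
    open ℚᵘₚ.≤-Reasoning
    cancel-denominator : ∀ m d → (ℤ.+ m ℤ.* ℤ.+ suc d) ℤ.* ℤ.+ 1 ≡ ℤ.+ m ℤ.* ℤ.+ suc (d ℕ.* 1)
    cancel-denominator m d rewrite ℕₚ.*-identityʳ d = ℤₚ.*-identityʳ _

  *-cancelʳ-≡ : ∀ {p q} r → r ≢ 0ℚ → p * r ≡ q * r → p ≡ q
  *-cancelʳ-≡ {p} {q} r r≢0 eq = begin
      p                  ≡⟨ sym (*-identityʳ p) ⟩
      p * 1ℚ             ≡⟨ cong (p *_) (sym (*-inverseʳ r)) ⟩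
      p * (r * r⁻¹)      ≡⟨ sym (*-assoc p r r⁻¹) ⟩
      p * r * r⁻¹        ≡⟨ cong (_* r⁻¹) eq ⟩
      q * r * r⁻¹        ≡⟨ *-assoc q r r⁻¹ ⟩
      q * (r * r⁻¹)      ≡⟨ cong (q *_) (*-inverseʳ r) ⟩
      q * 1ℚ             ≡⟨ *-identityʳ q ⟩
      q                  ∎
    where
    open ≡-Reasoning
    instance
      r-nonZero : ℚ.NonZero r
      r-nonZero = ℚ.≢-nonZero r≢0
    r⁻¹ = ℚ.1/ r

  ∑ : ℕ → (ℕ → ℚ) → ℚ
  ∑ zero    f = 0ℚ
  ∑ (suc n) f = f 0 + ∑ n (f ∘ suc)

  syntax ∑ n (λ i → e) = ∑[ i < n ] e

  ∑-cong : ∀ n {f g : ℕ → ℚ} → (∀ i → i < n → f i ≡ g i) → ∑ n f ≡ ∑ n g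
  ∑-cong zero    f≡g = refl
  ∑-cong (suc n) f≡g = cong₂ _+_ (f≡g 0 (s≤s z≤n)) (∑-cong n (λ i i<n → f≡g (suc i) (s≤s i<n)))

  ∑-zero : ∀ n {f : ℕ → ℚ} → (∀ i → i < n → f i ≡ 0ℚ) → ∑ n f ≡ 0ℚ
  ∑-zero n f≡0 = trans (∑-cong n f≡0) (∑-const-0 n)
    where
    ∑-const-0 : ∀ n → ∑[ i < n ] 0ℚ ≡ 0ℚ
    ∑-const-0 zero    = refl
    ∑-const-0 (suc n) = trans (+-identityˡ _) (∑-const-0 n)

  ∑-distrib-+ : ∀ n (f g : ℕ → ℚ) → ∑[ i < n ] (f i + g i) ≡ ∑ n f + ∑ n g
  ∑-distrib-+ zero    f g = refl
  ∑-distrib-+ (suc n) f g =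
    trans (cong (f 0 + g 0 +_) (∑-distrib-+ n (f ∘ suc) (g ∘ suc)))
          (interchange (f 0) (g 0) (∑ n (f ∘ suc)) (∑ n (g ∘ suc)))
    where
    interchange : ∀ a b c d → (a + b) + (c + d) ≡ (a + c) + (b + d)
    interchange = solve-∀ ℚ-ring

  ∑-distribˡ : ∀ n c (f : ℕ → ℚ) → c * ∑ n f ≡ ∑[ i < n ] (c * f i)
  ∑-distribˡ zero    c f = *-zeroʳ c
  ∑-distribˡ (suc n) c f = trans (*-distribˡ-+ c (f 0) _) (cong (c * f 0 +_) (∑-distribˡ n c (f ∘ suc)))

  ∑-init-last : ∀ n (f : ℕ → ℚ) → ∑ (suc n) f ≡ ∑ n f + f n
  ∑-init-last zero    f = trans (+-identityʳ (f 0)) (sym (+-identityˡ (f 0)))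
  ∑-init-last (suc n) f = trans (cong (f 0 +_) (∑-init-last n (f ∘ suc))) (sym (+-assoc (f 0) _ _))

  ∑-truncate : ∀ {m n} {f : ℕ → ℚ} → n ≤ m → (∀ i → n ≤ i → f i ≡ 0ℚ) → ∑ m f ≡ ∑ n f
  ∑-truncate {m} {zero}  _         f≡0 = ∑-zero m (λ i _ → f≡0 i z≤n)
  ∑-truncate {suc m} {suc n} {f} (s≤s n≤m) f≡0 = cong (f 0 +_) (∑-truncate n≤m (λ i n≤i → f≡0 (suc i) (s≤s n≤i)))

  sumℚ-upTo : ∀ n (f : ℕ → ℚ) → sumℚ (map f (upTo n)) ≡ ∑ n f
  sumℚ-upTo n f = sumℚ-applyUpTo n (λ i → i)
    where
    sumℚ-applyUpTo : ∀ n (g : ℕ → ℕ) → sumℚ (map f (applyUpTo g n)) ≡ ∑[ i < n ] f (g i)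
    sumℚ-applyUpTo zero    g = refl
    sumℚ-applyUpTo (suc n) g = cong (f (g 0) +_) (sumℚ-applyUpTo n (g ∘ suc))

  δ : ℕ → ℕ → ℚ
  δ i j = if i ≡ᵇ j then 1ℚ else 0ℚ

  ≡ᵇ-refl : ∀ n → (n ≡ᵇ n) ≡ true
  ≡ᵇ-refl n = dec-true (n ℕₚ.≟ n) refl

  ≢⇒≡ᵇ-false : ∀ m n → m ≢ n → (m ≡ᵇ n) ≡ false
  ≢⇒≡ᵇ-false m n = dec-false (m ℕₚ.≟ n)

  δ-refl : ∀ n → δ n n ≡ 1ℚ
  δ-refl n rewrite ≡ᵇ-refl n = refl

  δ-≢ : ∀ {m n} → m ≢ n → δ m n ≡ 0ℚ
  δ-≢ {m} {n} m≢n rewrite ≢⇒≡ᵇ-false m n m≢n = refl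

  δ-sym : ∀ m n → δ m n ≡ δ n m
  δ-sym zero    zero    = refl
  δ-sym zero    (suc n) = refl
  δ-sym (suc m) zero    = refl
  δ-sym (suc m) (suc n) = δ-sym m n

  ∑-δ : ∀ n {j} (f : ℕ → ℚ) → j < n → ∑[ i < n ] (δ i j * f i) ≡ f j
  ∑-δ (suc n) {zero}  f _ =
    trans (cong₂ _+_ (*-identityˡ (f 0)) (∑-zero n (λ i _ → *-zeroˡ (f (suc i))))) (+-identityʳ (f 0))
  ∑-δ (suc n) {suc j} f (s≤s j<n) =
    trans (cong₂ _+_ (*-zeroˡ (f 0)) (∑-δ n (f ∘ suc) j<n)) (+-identityˡ _)

  -- Formal power series over ℚ

  Series : Set
  Series = ℕ → ℚ

  infix  4 _≈_
  infixl 6 _⊕_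
  infixl 7 _⊛_
  infix  8 ⊖_

  _≈_ : Series → Series → Set
  a ≈ b = ∀ n → a n ≡ b n

  _⊕_ : Series → Series → Series
  (a ⊕ b) n = a n + b n

  ⊖_ : Series → Series
  (⊖ a) n = - a n

  _⊛_ : Series → Series → Series
  (a ⊛ b) n = ∑[ i < suc n ] (a i * b (n ∸ i))

  const : ℚ → Series
  const c zero    = c
  const c (suc n) = 0ℚ

  𝟘 𝟙 X : Series
  𝟘 _ = 0ℚ
  𝟙 = const 1ℚ
  X (suc zero) = 1ℚ
  X _          = 0ℚ

  tail : Series → Series
  tail a n = a (suc n)

  ≈-refl : ∀ {a} → a ≈ a
  ≈-refl n = refl

  ≈-sym : ∀ {a b} → a ≈ b → b ≈ a
  ≈-sym a≈b n = sym (a≈b n)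

  ≈-trans : ∀ {a b c} → a ≈ b → b ≈ c → a ≈ c
  ≈-trans a≈b b≈c n = trans (a≈b n) (b≈c n)

  ⊕-cong : ∀ {a a′ b b′} → a ≈ a′ → b ≈ b′ → a ⊕ b ≈ a′ ⊕ b′
  ⊕-cong a≈a′ b≈b′ n = cong₂ _+_ (a≈a′ n) (b≈b′ n)

  ⊛-cong : ∀ {a a′ b b′} → a ≈ a′ → b ≈ b′ → a ⊛ b ≈ a′ ⊛ b′
  ⊛-cong a≈a′ b≈b′ n = ∑-cong (suc n) (λ i _ → cong₂ _*_ (a≈a′ i) (b≈b′ (n ∸ i)))

  ⊕-congˡ : ∀ a {b b′} → b ≈ b′ → a ⊕ b ≈ a ⊕ b′
  ⊕-congˡ a b≈b′ n = cong (a n +_) (b≈b′ n)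

  ⊕-congʳ : ∀ b {a a′} → a ≈ a′ → a ⊕ b ≈ a′ ⊕ b
  ⊕-congʳ b a≈a′ n = cong (_+ b n) (a≈a′ n)

  ⊖-cong : ∀ {a b} → a ≈ b → ⊖ a ≈ ⊖ b
  ⊖-cong a≈b n = cong -_ (a≈b n)

  ⊛-congˡ : ∀ a {b b′} → b ≈ b′ → a ⊛ b ≈ a ⊛ b′
  ⊛-congˡ a {b} {b′} = ⊛-cong {a} {a} {b} {b′} ≈-refl

  ⊛-congʳ : ∀ b {a a′} → a ≈ a′ → a ⊛ b ≈ a′ ⊛ b
  ⊛-congʳ b {a} {a′} a≈a′ = ⊛-cong {a} {a′} {b} {b} a≈a′ ≈-refl

  ⊛-suc-last : ∀ a b n → (a ⊛ b) (suc n) ≡ (a ⊛ tail b) n + a (suc n) * b 0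
  ⊛-suc-last a b n = trans (∑-init-last (suc n) (λ i → a i * b (suc n ∸ i)))
    (cong₂ _+_ (∑-cong (suc n) (λ i i<1+n → cong (λ k → a i * b k) (ℕₚ.+-∸-assoc 1 (ℕₚ.≤-pred i<1+n))))
               (cong (λ k → a (suc n) * b k) (ℕₚ.n∸n≡0 n)))

  ⊛-comm : ∀ a b → a ⊛ b ≈ b ⊛ a
  ⊛-comm a b zero    = cong (_+ 0ℚ) (*-comm (a 0) (b 0))
  ⊛-comm a b (suc n) = begin
    a 0 * b (suc n) + (tail a ⊛ b) n  ≡⟨ cong₂ _+_ (*-comm (a 0) (b (suc n))) (⊛-comm (tail a) b n) ⟩
    b (suc n) * a 0 + (b ⊛ tail a) n  ≡⟨ +-comm (b (suc n) * a 0) ((b ⊛ tail a) n) ⟩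
    (b ⊛ tail a) n + b (suc n) * a 0  ≡⟨ ⊛-suc-last b a n ⟨
    (b ⊛ a) (suc n)                   ∎
    where open ≡-Reasoning

  ⊛-distribˡ : ∀ a b c → a ⊛ (b ⊕ c) ≈ a ⊛ b ⊕ a ⊛ c
  ⊛-distribˡ a b c n = trans (∑-cong (suc n) (λ i _ → *-distribˡ-+ (a i) (b (n ∸ i)) (c (n ∸ i))))
                             (∑-distrib-+ (suc n) (λ i → a i * b (n ∸ i)) (λ i → a i * c (n ∸ i)))

  ⊛-distribʳ : ∀ a b c → (b ⊕ c) ⊛ a ≈ b ⊛ a ⊕ c ⊛ a
  ⊛-distribʳ a b c = ≈-trans (⊛-comm (b ⊕ c) a)
                      (≈-trans (⊛-distribˡ a b c) (⊕-cong (⊛-comm a b) (⊛-comm a c)))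

  infixr 7 _·_
  _·_ : ℚ → Series → Series
  (c · a) n = c * a n

  const-⊛ : ∀ c a → const c ⊛ a ≈ c · a
  const-⊛ c a n = trans (cong (c * a n +_) (∑-zero n (λ i _ → *-zeroˡ (a (n ∸ suc i))))) (+-identityʳ _)

  ·-⊛ : ∀ c a b → (c · a) ⊛ b ≈ c · (a ⊛ b)
  ·-⊛ c a b n = trans (∑-cong (suc n) (λ i _ → *-assoc c (a i) (b (n ∸ i))))
                      (sym (∑-distribˡ (suc n) c (λ i → a i * b (n ∸ i))))

  ⊛-assoc : ∀ a b c → (a ⊛ b) ⊛ c ≈ a ⊛ (b ⊛ c)
  ⊛-assoc a b c zero    = constant-terms (a 0) (b 0) (c 0)
    where
    constant-terms : ∀ x y z → (x * y + 0ℚ) * z + 0ℚ ≡ x * (y * z + 0ℚ) + 0ℚ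
    constant-terms = solve-∀ ℚ-ring
  ⊛-assoc a b c (suc n) = begin
    (a 0 * b 0 + 0ℚ) * c (suc n) + ((a 0 · tail b ⊕ tail a ⊛ b) ⊛ c) n
      ≡⟨ cong (c₀ +_) (⊛-distribʳ c (a 0 · tail b) (tail a ⊛ b) n) ⟩
    (a 0 * b 0 + 0ℚ) * c (suc n) + (((a 0 · tail b) ⊛ c) n + ((tail a ⊛ b) ⊛ c) n)
      ≡⟨ cong₂ (λ s t → c₀ + (s + t)) (·-⊛ (a 0) (tail b) c n) (⊛-assoc (tail a) b c n) ⟩
    (a 0 * b 0 + 0ℚ) * c (suc n) + (a 0 * (tail b ⊛ c) n + (tail a ⊛ (b ⊛ c)) n)
      ≡⟨ regroup (a 0) (b 0) (c (suc n)) ((tail b ⊛ c) n) ((tail a ⊛ (b ⊛ c)) n) ⟩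
    a 0 * (b 0 * c (suc n) + (tail b ⊛ c) n) + (tail a ⊛ (b ⊛ c)) n
      ∎
    where
    open ≡-Reasoning
    c₀ = (a 0 * b 0 + 0ℚ) * c (suc n)
    regroup : ∀ x y z u v → (x * y + 0ℚ) * z + (x * u + v) ≡ x * (y * z + u) + v
    regroup = solve-∀ ℚ-ring

  𝟙-identityˡ : ∀ a → 𝟙 ⊛ a ≈ a
  𝟙-identityˡ a n = trans (const-⊛ 1ℚ a n) (*-identityˡ (a n))

  series-commutativeRing : CommutativeRing 0ℓ 0ℓ
  series-commutativeRing = record
    { Carrier = Series
    ; _≈_ = _≈_
    ; _+_ = _⊕_
    ; _*_ = _⊛_
    ; -_ = ⊖_
    ; 0# = 𝟘
    ; 1# = 𝟙
    ; isCommutativeRing = record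
      { isRing = record
        { +-isAbelianGroup = record
          { isGroup = record
            { isMonoid = record
              { isSemigroup = record
                { isMagma = record
                  { isEquivalence = record { refl = ≈-refl ; sym = ≈-sym ; trans = ≈-trans }
                  ; ∙-cong = ⊕-cong }
                ; assoc = λ a b c n → +-assoc (a n) (b n) (c n) }
              ; identity = (λ a n → +-identityˡ (a n)) , (λ a n → +-identityʳ (a n)) }
            ; inverse = (λ a n → +-inverseˡ (a n)) , (λ a n → +-inverseʳ (a n))
            ; ⁻¹-cong = λ a≈b n → cong -_ (a≈b n) }
          ; comm = λ a b n → +-comm (a n) (b n) }
        ; *-cong = ⊛-cong
        ; *-assoc = ⊛-assoc
        ; *-identity = 𝟙-identityˡ , (λ a → ≈-trans (⊛-comm a 𝟙) (𝟙-identityˡ a))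
        ; distrib = ⊛-distribˡ , ⊛-distribʳ }
      ; *-comm = ⊛-comm }
    }

  const-homo-+ : ∀ x y → const (x + y) ≈ const x ⊕ const y
  const-homo-+ x y zero    = refl
  const-homo-+ x y (suc n) = sym (+-identityʳ 0ℚ)

  series-almostCommutativeRing : RingSolverACR.AlmostCommutativeRing 0ℓ 0ℓ
  series-almostCommutativeRing = RingSolverACR.fromCommutativeRing series-commutativeRing

  const-homomorphism : +-*-rawRing RingSolverACR.-Raw-AlmostCommutative⟶ series-almostCommutativeRing
  const-homomorphism = record
    { ⟦_⟧    = const
    ; +-homo = const-homo-+
    ; *-homo = λ x y → ≈-sym (≈-trans (const-⊛ x (const y)) (λ { zero → refl ; (suc n) → *-zeroʳ x }))
    ; -‿homo = λ { x zero → refl ; x (suc n) → refl }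
    ; 0-homo = λ { zero → refl ; (suc n) → refl }
    ; 1-homo = λ { zero → refl ; (suc n) → refl }
    }

  const-≟ : (x y : ℚ) → Maybe (const x ≈ const y)
  const-≟ x y with x ≟ y
  ... | yes refl = just ≈-refl
  ... | no _     = nothing

  module SeriesSolver = RingSolver +-*-rawRing series-almostCommutativeRing const-homomorphism const-≟

  open SeriesSolver using (solve; _:=_; _:+_; _:*_; :-_; con)
  module ≈-Reasoning = SetoidReasoning (CommutativeRing.setoid series-commutativeRing)

  open import Algebra.Properties.Semiring.Exp (CommutativeRing.semiring series-commutativeRing) using (_^_)

  X-⊛-suc : ∀ a n → (X ⊛ a) (suc n) ≡ a n
  X-⊛-suc a n = trans (cong₂ _+_ (*-zeroˡ (a (suc n))) (𝟙-identityˡ a n)) (+-identityˡ (a n))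

  ⊛-suc-without-constants : ∀ a b → a 0 ≡ 0ℚ → b 0 ≡ 0ℚ → ∀ n → (a ⊛ b) (suc n) ≡ ∑[ j < n ] (a (suc j) * b (n ∸ j))
  ⊛-suc-without-constants a b a₀≡0 b₀≡0 n = begin
    a 0 * b (suc n) + (tail a ⊛ b) n
      ≡⟨ cong₂ _+_ (trans (cong (_* b (suc n)) a₀≡0) (*-zeroˡ (b (suc n)))) (∑-init-last n (λ j → a (suc j) * b (n ∸ j))) ⟩
    0ℚ + (∑[ j < n ] (a (suc j) * b (n ∸ j)) + a (suc n) * b (n ∸ n))
      ≡⟨ +-identityˡ _ ⟩
    ∑[ j < n ] (a (suc j) * b (n ∸ j)) + a (suc n) * b (n ∸ n)
      ≡⟨ cong (∑[ j < n ] (a (suc j) * b (n ∸ j)) +_)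
              (trans (cong (λ i → a (suc n) * b i) (ℕₚ.n∸n≡0 n)) (trans (cong (a (suc n) *_) b₀≡0) (*-zeroʳ (a (suc n))))) ⟩
    ∑[ j < n ] (a (suc j) * b (n ∸ j)) + 0ℚ
      ≡⟨ +-identityʳ _ ⟩
    ∑[ j < n ] (a (suc j) * b (n ∸ j)) ∎
    where open ≡-Reasoning

  𝟘^suc : ∀ n → 𝟘 ^ suc n ≈ 𝟘
  𝟘^suc n r = ∑-zero (suc r) (λ i _ → *-zeroˡ ((𝟘 ^ n) (r ∸ i)))

  ⊛-cancelˡ : ∀ c a → c 0 ≢ 0ℚ → c ⊛ a ≈ 𝟘 → a ≈ 𝟘
  ⊛-cancelˡ c a c₀≢0 ca≈0 = <-rec (λ m → a m ≡ 0ℚ) vanishes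
    where
    vanishes : ∀ m → (∀ {i} → i < m → a i ≡ 0ℚ) → a m ≡ 0ℚ
    vanishes m earlier = *-cancelʳ-≡ (c 0) c₀≢0 (begin
      a m * c 0                                  ≡⟨ +-identityˡ _ ⟨
      0ℚ + a m * c 0                             ≡⟨ cong₂ _+_ earlier-terms (cong (λ k → a m * c k) (ℕₚ.n∸n≡0 m)) ⟨
      ∑[ i < m ] (a i * c (m ∸ i)) + a m * c (m ∸ m) ≡⟨ ∑-init-last m (λ i → a i * c (m ∸ i)) ⟨
      (a ⊛ c) m                                  ≡⟨ ⊛-comm a c m ⟩
      (c ⊛ a) m                                  ≡⟨ ca≈0 m ⟩
      0ℚ                                         ≡⟨ *-zeroˡ (c 0) ⟨
      0ℚ * c 0                                   ∎)
      where
      open ≡-Reasoning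
      earlier-terms : ∑[ i < m ] (a i * c (m ∸ i)) ≡ 0ℚ
      earlier-terms = ∑-zero m (λ i i<m → trans (cong (_* c (m ∸ i)) (earlier i<m)) (*-zeroˡ (c (m ∸ i))))

  infix 4 X^_∣_ _≈[≤_]_

  X^_∣_ : ℕ → Series → Set
  X^ k ∣ a = ∀ i → i < k → a i ≡ 0ℚ

  X^∣-⊛ : ∀ {p q a b} → X^ p ∣ a → X^ q ∣ b → X^ (p ℕ.+ q) ∣ a ⊛ b
  X^∣-⊛ {p} {q} {a} {b} p∣a q∣b n n<p+q = ∑-zero (suc n) term-vanishes
    where
    term-vanishes : ∀ i → i < suc n → a i * b (n ∸ i) ≡ 0ℚ
    term-vanishes i i<1+n with i ℕₚ.<? p
    ... | yes i<p = trans (cong (_* b (n ∸ i)) (p∣a i i<p)) (*-zeroˡ (b (n ∸ i)))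
    ... | no  i≮p = trans (cong (a i *_) (q∣b (n ∸ i) n∸i<q)) (*-zeroʳ (a i))
      where
      n∸i<q : n ∸ i < q
      n∸i<q = ℕₚ.+-cancelˡ-< i (n ∸ i) q (ℕₚ.<-≤-trans
        (subst (_< p ℕ.+ q) (sym (ℕₚ.m+[n∸m]≡n (ℕₚ.≤-pred i<1+n))) n<p+q)
        (ℕₚ.+-monoˡ-≤ q (ℕₚ.≮⇒≥ i≮p)))

  X^∣-^ : ∀ {a} → X^ 1 ∣ a → ∀ n → X^ n ∣ a ^ n
  X^∣-^ X∣a zero    i ()
  X^∣-^ X∣a (suc n) = X^∣-⊛ X∣a (X^∣-^ X∣a n)

  _≈[≤_]_ : Series → ℕ → Series → Set
  a ≈[≤ d ] b = ∀ i → i ≤ d → a i ≡ b i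

  ≈[≤]-⊛ : ∀ {d a a′ b b′} → a ≈[≤ d ] a′ → b ≈[≤ d ] b′ → a ⊛ b ≈[≤ d ] a′ ⊛ b′
  ≈[≤]-⊛ a≈a′ b≈b′ n n≤d = ∑-cong (suc n) (λ i i<1+n →
    cong₂ _*_ (a≈a′ i (ℕₚ.≤-trans (ℕₚ.≤-pred i<1+n) n≤d)) (b≈b′ (n ∸ i) (ℕₚ.≤-trans (ℕₚ.m∸n≤m n i) n≤d)))

  ≈[≤]-^ : ∀ {d a b} n → a ≈[≤ d ] b → a ^ n ≈[≤ d ] b ^ n
  ≈[≤]-^ zero    a≈b i _ = refl
  ≈[≤]-^ (suc n) a≈b = ≈[≤]-⊛ a≈b (≈[≤]-^ n a≈b)

  -- The Euler operator θ = x d/dx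

  θ : Series → Series
  θ a n = ℕtoℚ n * a n

  θ-cong : ∀ {a b} → a ≈ b → θ a ≈ θ b
  θ-cong a≈b n = cong (ℕtoℚ n *_) (a≈b n)

  θ-⊕ : ∀ a b → θ (a ⊕ b) ≈ θ a ⊕ θ b
  θ-⊕ a b n = *-distribˡ-+ (ℕtoℚ n) (a n) (b n)

  θ-⊖ : ∀ a → θ (⊖ a) ≈ ⊖ θ a
  θ-⊖ a n = sym (neg-distribʳ-* (ℕtoℚ n) (a n))

  θ-const : ∀ c → θ (const c) ≈ 𝟘
  θ-const c zero    = *-zeroˡ c
  θ-const c (suc n) = *-zeroʳ (ℕtoℚ (suc n))

  θ-X : θ X ≈ X
  θ-X zero          = refl
  θ-X (suc zero)    = refl
  θ-X (suc (suc n)) = *-zeroʳ (ℕtoℚ (suc (suc n)))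

  θ-⊛ : ∀ a b → θ (a ⊛ b) ≈ θ a ⊛ b ⊕ a ⊛ θ b
  θ-⊛ a b n = begin
    ℕtoℚ n * ∑[ i < suc n ] (a i * b (n ∸ i))
      ≡⟨ ∑-distribˡ (suc n) (ℕtoℚ n) (λ i → a i * b (n ∸ i)) ⟩
    ∑[ i < suc n ] (ℕtoℚ n * (a i * b (n ∸ i)))
      ≡⟨ ∑-cong (suc n) (λ i i<1+n → leibniz i (ℕₚ.≤-pred i<1+n)) ⟩
    ∑[ i < suc n ] (ℕtoℚ i * a i * b (n ∸ i) + a i * (ℕtoℚ (n ∸ i) * b (n ∸ i)))
      ≡⟨ ∑-distrib-+ (suc n) (λ i → ℕtoℚ i * a i * b (n ∸ i)) (λ i → a i * (ℕtoℚ (n ∸ i) * b (n ∸ i))) ⟩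
    (θ a ⊛ b ⊕ a ⊛ θ b) n ∎
    where
    open ≡-Reasoning
    distribute : ∀ p q x y → (p + q) * (x * y) ≡ p * x * y + x * (q * y)
    distribute = solve-∀ ℚ-ring
    leibniz : ∀ i → i ≤ n → ℕtoℚ n * (a i * b (n ∸ i)) ≡ ℕtoℚ i * a i * b (n ∸ i) + a i * (ℕtoℚ (n ∸ i) * b (n ∸ i))
    leibniz i i≤n = begin
      ℕtoℚ n * (a i * b (n ∸ i))                 ≡⟨ cong (λ k → ℕtoℚ k * (a i * b (n ∸ i))) (ℕₚ.m+[n∸m]≡n i≤n) ⟨
      ℕtoℚ (i ℕ.+ (n ∸ i)) * (a i * b (n ∸ i))   ≡⟨ cong (_* (a i * b (n ∸ i))) (ℕtoℚ-homo-+ i (n ∸ i)) ⟩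
      (ℕtoℚ i + ℕtoℚ (n ∸ i)) * (a i * b (n ∸ i)) ≡⟨ distribute (ℕtoℚ i) (ℕtoℚ (n ∸ i)) (a i) (b (n ∸ i)) ⟩
      ℕtoℚ i * a i * b (n ∸ i) + a i * (ℕtoℚ (n ∸ i) * b (n ∸ i)) ∎

  θ-⊛′ : ∀ {a a′ b b′} → θ a ≈ a′ → θ b ≈ b′ → θ (a ⊛ b) ≈ a′ ⊛ b ⊕ a ⊛ b′
  θ-⊛′ {a} {a′} {b} {b′} θa≈a′ θb≈b′ = ≈-trans (θ-⊛ a b) (⊕-cong (⊛-congʳ b θa≈a′) (⊛-congˡ a θb≈b′))

  θ-const-⊛ : ∀ c a → θ (const c ⊛ a) ≈ const c ⊛ θ a
  θ-const-⊛ c a n = begin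
    ℕtoℚ n * (const c ⊛ a) n ≡⟨ cong (ℕtoℚ n *_) (const-⊛ c a n) ⟩
    ℕtoℚ n * (c * a n)       ≡⟨ swap-factors (ℕtoℚ n) c (a n) ⟩
    c * (ℕtoℚ n * a n)       ≡⟨ const-⊛ c (θ a) n ⟨
    (const c ⊛ θ a) n        ∎
    where
    open ≡-Reasoning
    swap-factors : ∀ x y z → x * (y * z) ≡ y * (x * z)
    swap-factors = solve-∀ ℚ-ring

  θ-const-⊖ : ∀ c a → θ (const c ⊕ ⊖ a) ≈ ⊖ θ a
  θ-const-⊖ c a n = trans (θ-⊕ (const c) (⊖ a) n)
                          (trans (cong₂ _+_ (θ-const c n) (θ-⊖ a n)) (+-identityˡ _))

  -- A hypergeometric equation

  -- The hypergeometric operator of ₂F₁(-1/4, 1/4; 1/2; 4x), multiplied by 4.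
  hypergeometric : Series → Series
  hypergeometric U =
    const (ℕtoℚ 4) ⊛ ((𝟙 ⊕ ⊖ (const (ℕtoℚ 4) ⊛ X)) ⊛ θ (θ U)) ⊕ ⊖ (const (ℕtoℚ 2) ⊛ θ U) ⊕ X ⊛ U

  module _ (U : Series) where
    private
      c : ℕ → Series
      c k = const (ℕtoℚ k)
      W  = U ⊛ U
      T  = θ U
      T₂ = θ T
      S  = 𝟙 ⊕ ⊖ (c 2 ⊛ W)
      E₀ = W ⊛ (𝟙 ⊕ ⊖ W)
      E₁ = c 2 ⊛ (S ⊛ (U ⊛ T))
      E₂ = c 2 ⊛ (S ⊛ (T ⊛ T ⊕ U ⊛ T₂)) ⊕ ⊖ (c 8 ⊛ (W ⊛ (T ⊛ T)))

    θE₀≈E₁ : θ E₀ ≈ E₁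
    θE₀≈E₁ = begin
      θ (W ⊛ (𝟙 ⊕ ⊖ W))            ≈⟨ θ-⊛′ (θ-⊛ U U) (≈-trans (θ-const-⊖ 1ℚ W) (⊖-cong (θ-⊛ U U))) ⟩
      θW ⊛ (𝟙 ⊕ ⊖ W) ⊕ W ⊛ (⊖ θW) ≈⟨ solve 2 (λ u t →
                                       (t :* u :+ u :* t) :* (con 1ℚ :+ :- (u :* u)) :+ (u :* u) :* (:- (t :* u :+ u :* t))
                                       := con (ℕtoℚ 2) :* ((con 1ℚ :+ :- (con (ℕtoℚ 2) :* (u :* u))) :* (u :* t)))
                                     ≈-refl U T ⟩
      E₁                           ∎
      where
      open ≈-Reasoning
      θW = T ⊛ U ⊕ U ⊛ T

    θE₁≈E₂ : θ E₁ ≈ E₂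
    θE₁≈E₂ = begin
      θ (c 2 ⊛ (S ⊛ (U ⊛ T)))
        ≈⟨ ≈-trans (θ-const-⊛ (ℕtoℚ 2) (S ⊛ (U ⊛ T))) (⊛-congˡ (c 2) (θ-⊛′ θS≈ (θ-⊛ U T))) ⟩
      c 2 ⊛ (θS ⊛ (U ⊛ T) ⊕ S ⊛ (T ⊛ T ⊕ U ⊛ T₂))
        ≈⟨ solve 3 (λ u t t₂ →
             con (ℕtoℚ 2) :* ((:- (con (ℕtoℚ 2) :* (t :* u :+ u :* t))) :* (u :* t)
                              :+ (con 1ℚ :+ :- (con (ℕtoℚ 2) :* (u :* u))) :* (t :* t :+ u :* t₂))
             := con (ℕtoℚ 2) :* ((con 1ℚ :+ :- (con (ℕtoℚ 2) :* (u :* u))) :* (t :* t :+ u :* t₂))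
                :+ :- (con (ℕtoℚ 8) :* ((u :* u) :* (t :* t))))
             ≈-refl U T T₂ ⟩
      E₂ ∎
      where
      open ≈-Reasoning
      θS = ⊖ (c 2 ⊛ (T ⊛ U ⊕ U ⊛ T))
      θS≈ : θ S ≈ θS
      θS≈ = ≈-trans (θ-const-⊖ 1ℚ (c 2 ⊛ W)) (⊖-cong (≈-trans (θ-const-⊛ (ℕtoℚ 2) W) (⊛-congˡ (c 2) (θ-⊛ U U))))

    private
      multiplier C₀ C₁ C₂ : Series
      multiplier = c 2 ⊛ (S ⊛ (U ⊛ W))
      C₂ = c 4 ⊛ (W ⊛ (𝟙 ⊕ ⊖ (c 4 ⊛ X)))
      C₁ = c 8 ⊛ W ⊛ (X ⊕ E₁) ⊕ ⊖ (c 4 ⊛ ((𝟙 ⊕ ⊖ (c 4 ⊛ X)) ⊛ (U ⊛ T))) ⊕ ⊖ (c 2 ⊛ W) ⊕ ⊖ (c 2 ⊛ (S ⊛ X))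
      C₀ = c 128 ⊛ (W ⊛ ((U ⊛ T) ⊛ (U ⊛ T))) ⊕ ⊖ (c 16 ⊛ ((U ⊛ T) ⊛ X)) ⊕ X ⊛ (c 4 ⊛ W ⊕ c 2)

    hypergeometric-certificate :
      multiplier ⊛ hypergeometric U ≈ C₂ ⊛ (E₂ ⊕ ⊖ X) ⊕ C₁ ⊛ (E₁ ⊕ ⊖ X) ⊕ C₀ ⊛ (E₀ ⊕ ⊖ X)
    hypergeometric-certificate = solve 4 (λ u t t₂ x →
      let w    = u :* u
          s    = con 1ℚ :+ :- (con (ℕtoℚ 2) :* w)
          ut   = u :* t
          1-4x = con 1ℚ :+ :- (con (ℕtoℚ 4) :* x)
          e₀   = w :* (con 1ℚ :+ :- w)
          e₁   = con (ℕtoℚ 2) :* (s :* ut)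
          e₂   = con (ℕtoℚ 2) :* (s :* (t :* t :+ u :* t₂)) :+ :- (con (ℕtoℚ 8) :* (w :* (t :* t)))
      in (con (ℕtoℚ 2) :* (s :* (u :* w))) :* (con (ℕtoℚ 4) :* (1-4x :* t₂) :+ :- (con (ℕtoℚ 2) :* t) :+ x :* u)
         := (con (ℕtoℚ 4) :* (w :* 1-4x)) :* (e₂ :+ :- x)
            :+ (con (ℕtoℚ 8) :* w :* (x :+ e₁) :+ :- (con (ℕtoℚ 4) :* (1-4x :* ut))
                :+ :- (con (ℕtoℚ 2) :* w) :+ :- (con (ℕtoℚ 2) :* (s :* x))) :* (e₁ :+ :- x)
            :+ (con (ℕtoℚ 128) :* (w :* (ut :* ut)) :+ :- (con (ℕtoℚ 16) :* (ut :* x))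
                :+ x :* (con (ℕtoℚ 4) :* w :+ con (ℕtoℚ 2))) :* (e₀ :+ :- x))
      ≈-refl U T T₂ X

    quartic⇒hypergeometric : U 0 ≡ 1ℚ → E₀ ≈ X → hypergeometric U ≈ 𝟘
    quartic⇒hypergeometric U₀≡1 E₀≈X = ⊛-cancelˡ multiplier (hypergeometric U) multiplier₀≢0 (begin
      multiplier ⊛ hypergeometric U                        ≈⟨ hypergeometric-certificate ⟩
      C₂ ⊛ (E₂ ⊕ ⊖ X) ⊕ C₁ ⊛ (E₁ ⊕ ⊖ X) ⊕ C₀ ⊛ (E₀ ⊕ ⊖ X) ≈⟨ ⊕-cong (⊕-cong (annihilates C₂ E₂≈X) (annihilates C₁ E₁≈X))
                                                                    (annihilates C₀ E₀≈X) ⟩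
      𝟘 ⊕ 𝟘 ⊕ 𝟘                                            ≈⟨ (λ n → trans (+-identityʳ _) (+-identityʳ 0ℚ)) ⟩
      𝟘                                                    ∎)
      where
      open ≈-Reasoning
      E₁≈X : E₁ ≈ X
      E₁≈X = ≈-trans (≈-sym θE₀≈E₁) (≈-trans (θ-cong E₀≈X) θ-X)
      E₂≈X : E₂ ≈ X
      E₂≈X = ≈-trans (≈-sym θE₁≈E₂) (≈-trans (θ-cong E₁≈X) θ-X)
      annihilates : ∀ a {b} → b ≈ X → a ⊛ (b ⊕ ⊖ X) ≈ 𝟘
      annihilates a {b} b≈X n =
        trans (⊛-congˡ a (λ i → trans (cong (_+ - X i) (b≈X i)) (+-inverseʳ (X i))) n)
              (∑-zero (suc n) (λ i _ → *-zeroʳ (a i)))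
      multiplier₀≢0 : multiplier 0 ≢ 0ℚ
      multiplier₀≢0 rewrite U₀≡1 = λ ()

  hypergeometric-coeff : ∀ U g → hypergeometric U (suc g)
    ≡ ℕtoℚ 4 * θ (θ U) (suc g) + - (ℕtoℚ 16 * θ (θ U) g) + - (ℕtoℚ 2 * θ U (suc g)) + U g
  hypergeometric-coeff U g = begin
    hypergeometric U (suc g)
      ≡⟨ expand (suc g) ⟩
    (c 4 ⊛ θ (θ U)) (suc g) + - (c 16 ⊛ (X ⊛ θ (θ U))) (suc g) + - (c 2 ⊛ θ U) (suc g) + (X ⊛ U) (suc g)
      ≡⟨ cong₂ _+_ (cong₂ _+_ (cong₂ _+_ (const-⊛ (ℕtoℚ 4) (θ (θ U)) (suc g))
                                       (cong -_ (trans (const-⊛ (ℕtoℚ 16) (X ⊛ θ (θ U)) (suc g))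
                                                       (cong (ℕtoℚ 16 *_) (X-⊛-suc (θ (θ U)) g)))))
                            (cong -_ (const-⊛ (ℕtoℚ 2) (θ U) (suc g))))
                   (X-⊛-suc U g) ⟩
    ℕtoℚ 4 * θ (θ U) (suc g) + - (ℕtoℚ 16 * θ (θ U) g) + - (ℕtoℚ 2 * θ U (suc g)) + U g ∎
    where
    open ≡-Reasoning
    c : ℕ → Series
    c k = const (ℕtoℚ k)
    expand : hypergeometric U ≈ c 4 ⊛ θ (θ U) ⊕ ⊖ (c 16 ⊛ (X ⊛ θ (θ U))) ⊕ ⊖ (c 2 ⊛ θ U) ⊕ X ⊛ U
    expand = solve 4 (λ t₂ t u x →
      con (ℕtoℚ 4) :* ((con 1ℚ :+ :- (con (ℕtoℚ 4) :* x)) :* t₂) :+ :- (con (ℕtoℚ 2) :* t) :+ x :* u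
      := con (ℕtoℚ 4) :* t₂ :+ :- (con (ℕtoℚ 16) :* (x :* t₂)) :+ :- (con (ℕtoℚ 2) :* t) :+ x :* u)
      ≈-refl (θ (θ U)) (θ U) U X

  leading trailing : ℕ → ℚ
  leading  h = (ℕtoℚ 2 + ℕtoℚ h) * (ℕtoℚ 6 + ℕtoℚ 4 * ℕtoℚ h)
  trailing h = (ℕtoℚ 3 + ℕtoℚ 4 * ℕtoℚ h) * (ℕtoℚ 5 + ℕtoℚ 4 * ℕtoℚ h)

  hypergeometric-recurrence : ∀ U → hypergeometric U ≈ 𝟘 → ∀ h → leading h * U (2 ℕ.+ h) ≡ trailing h * U (suc h)
  hypergeometric-recurrence U LU≈0 h = begin
    leading h * U (2 ℕ.+ h)                  ≡⟨ split-off-coeff y (U (suc h)) (U (2 ℕ.+ h)) ⟩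
    rhs + coeff (ℕtoℚ 2 + y) (1ℚ + y)        ≡⟨ cong (rhs +_) coeff≡hypergeometric ⟩
    rhs + hypergeometric U (2 ℕ.+ h)         ≡⟨ cong (rhs +_) (LU≈0 (2 ℕ.+ h)) ⟩
    rhs + 0ℚ                                 ≡⟨ +-identityʳ rhs ⟩
    rhs                                      ∎
    where
    open ≡-Reasoning
    y = ℕtoℚ h
    rhs = trailing h * U (suc h)
    coeff : ℚ → ℚ → ℚ
    coeff a b = ℕtoℚ 4 * (a * (a * U (2 ℕ.+ h))) + - (ℕtoℚ 16 * (b * (b * U (suc h)))) + - (ℕtoℚ 2 * (a * U (2 ℕ.+ h))) + U (suc h)
    coeff≡hypergeometric : coeff (ℕtoℚ 2 + y) (1ℚ + y) ≡ hypergeometric U (2 ℕ.+ h)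
    coeff≡hypergeometric = sym (trans (hypergeometric-coeff U (suc h)) (cong₂ coeff (ℕtoℚ-homo-+ 2 h) (ℕtoℚ-suc h)))
    split-off-coeff : ∀ y u₁ u₂ →
      (ℕtoℚ 2 + y) * (ℕtoℚ 6 + ℕtoℚ 4 * y) * u₂
        ≡ (ℕtoℚ 3 + ℕtoℚ 4 * y) * (ℕtoℚ 5 + ℕtoℚ 4 * y) * u₁
          + (ℕtoℚ 4 * ((ℕtoℚ 2 + y) * ((ℕtoℚ 2 + y) * u₂)) + - (ℕtoℚ 16 * ((1ℚ + y) * ((1ℚ + y) * u₁)))
             + - (ℕtoℚ 2 * ((ℕtoℚ 2 + y) * u₂)) + u₁)
    split-off-coeff = solve-∀ ℚ-ring

  leading≢0 : ∀ h → leading h ≢ 0ℚ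
  leading≢0 h = ℕtoℚ-nonZero ((2 ℕ.+ h) ℕ.* (6 ℕ.+ 4 ℕ.* h)) ∘ trans (begin
    ℕtoℚ ((2 ℕ.+ h) ℕ.* (6 ℕ.+ 4 ℕ.* h))     ≡⟨ ℕtoℚ-homo-* (2 ℕ.+ h) (6 ℕ.+ 4 ℕ.* h) ⟩
    ℕtoℚ (2 ℕ.+ h) * ℕtoℚ (6 ℕ.+ 4 ℕ.* h)    ≡⟨ cong₂ _*_ (ℕtoℚ-homo-+ 2 h)
                                                          (trans (ℕtoℚ-homo-+ 6 (4 ℕ.* h)) (cong (ℕtoℚ 6 +_) (ℕtoℚ-homo-* 4 h))) ⟩
    leading h                                ∎)
    where open ≡-Reasoning

  -- The multinomial theorem

  module _ {A : Set} where

    sumℚ-++ : ∀ (f : A → ℚ) xs ys → sumℚ (map f (xs ++ ys)) ≡ sumℚ (map f xs) + sumℚ (map f ys)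
    sumℚ-++ f []       ys = sym (+-identityˡ _)
    sumℚ-++ f (x ∷ xs) ys = trans (cong (f x +_) (sumℚ-++ f xs ys)) (sym (+-assoc (f x) _ _))

    sumℚ-cong : ∀ {f g : A → ℚ} xs → (∀ x → f x ≡ g x) → sumℚ (map f xs) ≡ sumℚ (map g xs)
    sumℚ-cong []       f≗g = refl
    sumℚ-cong (x ∷ xs) f≗g = cong₂ _+_ (f≗g x) (sumℚ-cong xs f≗g)

    sumℚ-distribˡ : ∀ c (f : A → ℚ) xs → c * sumℚ (map f xs) ≡ sumℚ (map (λ x → c * f x) xs)
    sumℚ-distribˡ c f []       = *-zeroʳ c
    sumℚ-distribˡ c f (x ∷ xs) = trans (*-distribˡ-+ c (f x) _) (cong (c * f x +_) (sumℚ-distribˡ c f xs))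

    sumℚ-∑ : ∀ K (f : A → ℕ → ℚ) xs → sumℚ (map (λ x → ∑ K (f x)) xs) ≡ ∑[ n < K ] sumℚ (map (λ x → f x n) xs)
    sumℚ-∑ K f []       = sym (∑-zero K (λ _ _ → refl))
    sumℚ-∑ K f (x ∷ xs) = trans (cong (∑ K (f x) +_) (sumℚ-∑ K f xs))
                                (sym (∑-distrib-+ K (f x) (λ n → sumℚ (map (λ y → f y n) xs))))

    sumℚ-filter : ∀ {P : Pred A 0ℓ} (P? : Decidable P) (f : A → ℚ) xs →
                  sumℚ (map f (filter P? xs)) ≡ sumℚ (map (λ x → if does (P? x) then f x else 0ℚ) xs)
    sumℚ-filter P? f []       = refl
    sumℚ-filter P? f (x ∷ xs) with does (P? x)
    ... | true  = cong (f x +_) (sumℚ-filter P? f xs)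
    ... | false = trans (sumℚ-filter P? f xs) (sym (+-identityˡ _))

  sumℚ-concatMap : ∀ {A B : Set} (f : B → ℚ) (g : A → List B) xs →
                   sumℚ (map f (concatMap g xs)) ≡ sumℚ (map (λ x → sumℚ (map f (g x))) xs)
  sumℚ-concatMap f g []       = refl
  sumℚ-concatMap f g (x ∷ xs) = trans (sumℚ-++ f (g x) (concatMap g xs)) (cong (sumℚ (map f (g x)) +_) (sumℚ-concatMap f g xs))

  boxSum : ∀ m N → (Vec ℕ m → ℚ) → ℚ
  boxSum m N F = sumℚ (map F (box m N))

  boxSum-suc : ∀ m N F → boxSum (suc m) N F ≡ ∑[ k < N ] boxSum m N (λ ks → F (k ∷ ks))
  boxSum-suc m N F = begin
    sumℚ (map F (concatMap (λ k → map (k ∷_) (box m N)) (upTo N)))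
      ≡⟨ sumℚ-concatMap F (λ k → map (k ∷_) (box m N)) (upTo N) ⟩
    sumℚ (map (λ k → sumℚ (map F (map (k ∷_) (box m N)))) (upTo N))
      ≡⟨ sumℚ-cong (upTo N) (λ k → cong sumℚ (sym (map-∘ (box m N)))) ⟩
    sumℚ (map (λ k → boxSum m N (λ ks → F (k ∷ ks))) (upTo N))
      ≡⟨ sumℚ-upTo N (λ k → boxSum m N (λ ks → F (k ∷ ks))) ⟩
    ∑[ k < N ] boxSum m N (λ ks → F (k ∷ ks)) ∎
    where open ≡-Reasoning

  boxSum-cong : ∀ m N {F G : Vec ℕ m → ℚ} → (∀ ks → F ks ≡ G ks) → boxSum m N F ≡ boxSum m N G
  boxSum-cong m N = sumℚ-cong (box m N)

  boxSum-distribˡ : ∀ m N c F → c * boxSum m N F ≡ boxSum m N (λ ks → c * F ks)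
  boxSum-distribˡ m N c F = sumℚ-distribˡ c F (box m N)

  δ≤ : ℕ → ℕ → ℚ
  δ≤ zero    r       = 1ℚ
  δ≤ (suc a) zero    = 0ℚ
  δ≤ (suc a) (suc r) = δ≤ a r

  δ≤-yes : ∀ {a r} → a ≤ r → δ≤ a r ≡ 1ℚ
  δ≤-yes {zero}  _         = refl
  δ≤-yes {suc a} (s≤s a≤r) = δ≤-yes a≤r

  δ≤-no : ∀ {a r} → r < a → δ≤ a r ≡ 0ℚ
  δ≤-no {suc a} {zero}  _         = refl
  δ≤-no {suc a} {suc r} (s≤s r<a) = δ≤-no r<a

  δ≤-+ : ∀ a b r → δ≤ a r * δ≤ b (r ∸ a) ≡ δ≤ (a ℕ.+ b) r
  δ≤-+ zero    b r       = *-identityˡ (δ≤ b r)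
  δ≤-+ (suc a) b zero    = *-zeroˡ (δ≤ b 0)
  δ≤-+ (suc a) b (suc r) = δ≤-+ a b r

  δ-+ : ∀ a w r → δ (a ℕ.+ w) r ≡ δ≤ a r * δ w (r ∸ a)
  δ-+ zero    w r       = sym (*-identityˡ (δ w r))
  δ-+ (suc a) w zero    = sym (*-zeroˡ (δ w 0))
  δ-+ (suc a) w (suc r) = δ-+ a w r

  δ-+-binomial : ∀ k t n → δ (k ℕ.+ t) n * ℕtoℚ ((k ℕ.+ t) C k) ≡ δ≤ k n * (ℕtoℚ (n C k) * δ t (n ∸ k))
  δ-+-binomial k t n = trans (cong (_* ℕtoℚ ((k ℕ.+ t) C k)) (δ-+ k t n)) (by-cases (t ℕₚ.≟ n ∸ k))
    where
    regroup : ∀ a b c → a * b * c ≡ a * (c * b)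
    regroup = solve-∀ ℚ-ring
    vanish-middle : ∀ a c d → a * 0ℚ * c ≡ a * (d * 0ℚ)
    vanish-middle = solve-∀ ℚ-ring
    vanish-left : ∀ b c d → 0ℚ * b * c ≡ 0ℚ * (d * b)
    vanish-left = solve-∀ ℚ-ring
    by-cases : Dec (t ≡ n ∸ k) → δ≤ k n * δ t (n ∸ k) * ℕtoℚ ((k ℕ.+ t) C k) ≡ δ≤ k n * (ℕtoℚ (n C k) * δ t (n ∸ k))
    by-cases (no t≢n∸k) rewrite δ-≢ t≢n∸k = vanish-middle (δ≤ k n) (ℕtoℚ ((k ℕ.+ t) C k)) (ℕtoℚ (n C k))
    by-cases (yes refl) with k ℕₚ.≤? n
    ... | yes k≤n rewrite ℕₚ.m+[n∸m]≡n k≤n = regroup (δ≤ k n) (δ (n ∸ k) (n ∸ k)) (ℕtoℚ (n C k))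
    ... | no  k≰n rewrite δ≤-no (ℕₚ.≰⇒> k≰n) = vanish-left (δ (n ∸ k) (n ∸ k)) (ℕtoℚ ((k ℕ.+ (n ∸ k)) C k)) (ℕtoℚ (n C k))

  module SeriesBinomial = Binomial (CommutativeRing.commutativeSemiring series-commutativeRing)
  open RawMonoid (CommutativeRing.+-rawMonoid series-commutativeRing) using (_×_; sum)

  ×-coeff : ∀ c a r → (c × a) r ≡ ℕtoℚ c * a r
  ×-coeff zero    a r = sym (*-zeroˡ (a r))
  ×-coeff (suc c) a r = begin
    a r + (c × a) r        ≡⟨ cong (a r +_) (×-coeff c a r) ⟩
    a r + ℕtoℚ c * a r     ≡⟨ cong (_+ ℕtoℚ c * a r) (*-identityˡ (a r)) ⟨
    1ℚ * a r + ℕtoℚ c * a r ≡⟨ *-distribʳ-+ (a r) 1ℚ (ℕtoℚ c) ⟨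
    (1ℚ + ℕtoℚ c) * a r    ≡⟨ cong (_* a r) (ℕtoℚ-suc c) ⟨
    ℕtoℚ (suc c) * a r     ∎
    where open ≡-Reasoning

  sum-coeff : ∀ n (F : Fin n → Series) (g : ℕ → ℚ) r → (∀ i → F i r ≡ g (toℕ i)) → sum F r ≡ ∑ n g
  sum-coeff zero    F g r F≗g = refl
  sum-coeff (suc n) F g r F≗g = cong₂ _+_ (F≗g fzero) (sum-coeff n (F ∘ fsuc) (g ∘ suc) r (F≗g ∘ fsuc))

  ^-binomial : ∀ a b n r → ((a ⊕ b) ^ n) r ≡ ∑[ k < suc n ] (ℕtoℚ (n C k) * ((a ^ k) ⊛ (b ^ (n ∸ k))) r)
  ^-binomial a b n r = trans (SeriesBinomial.theorem n a b r)
    (sum-coeff (suc n) (SeriesBinomial.binomialTerm a b n) (λ k → ℕtoℚ (n C k) * ((a ^ k) ⊛ (b ^ (n ∸ k))) r) r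
               (λ k → ×-coeff (n C toℕ k) ((a ^ toℕ k) ⊛ (b ^ (n ∸ toℕ k))) r))

  nCk*k!*[n∸k]!≡n! : ∀ {n k} → k ≤ n → (n C k) ℕ.* (k ! ℕ.* (n ∸ k) !) ≡ n !
  nCk*k!*[n∸k]!≡n! {n} {k} k≤n = begin
    (n C k) ℕ.* (k ! ℕ.* (n ∸ k) !)                    ≡⟨ cong (ℕ._* (k ! ℕ.* (n ∸ k) !)) (nCk≡n!/k![n-k]! k≤n) ⟩
    (n ! ℕ./ (k ! ℕ.* (n ∸ k) !)) ℕ.* (k ! ℕ.* (n ∸ k) !) ≡⟨ ℕₚ.*-comm _ (k ! ℕ.* (n ∸ k) !) ⟩
    (k ! ℕ.* (n ∸ k) !) ℕ.* (n ! ℕ./ (k ! ℕ.* (n ∸ k) !)) ≡⟨ m*[n/m]≡n (k![n∸k]!∣n! k≤n) ⟩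
    n !                                                 ∎
    where
    open ≡-Reasoning
    instance
      k![n∸k]!≢0 : NonZero (k ! ℕ.* (n ∸ k) !)
      k![n∸k]!≢0 = k ℕₚ.!* (n ∸ k) !≢0

  multinomial-∷ : ∀ {m} k (ks : Vec ℕ m) → multinomial (k ∷ ks) ≡ ℕtoℚ ((k ℕ.+ total ks) C k) * multinomial ks
  multinomial-∷ k ks = *-cancelʳ-≡ (ℕtoℚ (k ! ℕ.* prodFact ks)) (ℕtoℚ-nonZero _ {{prodFact≢0 (k ∷ ks)}}) (begin
    multinomial (k ∷ ks) * ℕtoℚ (k ! ℕ.* prodFact ks)
      ≡⟨ /-*-ℕtoℚ ((k ℕ.+ t) !) (k ! ℕ.* prodFact ks) {{prodFact≢0 (k ∷ ks)}} ⟩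
    ℕtoℚ ((k ℕ.+ t) !)
      ≡⟨ cong ℕtoℚ (nCk*k!*[n∸k]!≡n! (ℕₚ.m≤m+n k t)) ⟨
    ℕtoℚ (((k ℕ.+ t) C k) ℕ.* (k ! ℕ.* (k ℕ.+ t ∸ k) !))
      ≡⟨ cong (λ j → ℕtoℚ (((k ℕ.+ t) C k) ℕ.* (k ! ℕ.* j !))) (ℕₚ.m+n∸m≡n k t) ⟩
    ℕtoℚ (((k ℕ.+ t) C k) ℕ.* (k ! ℕ.* t !))
      ≡⟨ trans (ℕtoℚ-homo-* ((k ℕ.+ t) C k) (k ! ℕ.* t !)) (cong (ℕtoℚ ((k ℕ.+ t) C k) *_) (ℕtoℚ-homo-* (k !) (t !))) ⟩
    ℕtoℚ ((k ℕ.+ t) C k) * (ℕtoℚ (k !) * ℕtoℚ (t !))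
      ≡⟨ cong (λ q → ℕtoℚ ((k ℕ.+ t) C k) * (ℕtoℚ (k !) * q)) (/-*-ℕtoℚ (t !) (prodFact ks) {{prodFact≢0 ks}}) ⟨
    ℕtoℚ ((k ℕ.+ t) C k) * (ℕtoℚ (k !) * (multinomial ks * ℕtoℚ (prodFact ks)))
      ≡⟨ regroup (ℕtoℚ ((k ℕ.+ t) C k)) (ℕtoℚ (k !)) (multinomial ks) (ℕtoℚ (prodFact ks)) ⟩
    ℕtoℚ ((k ℕ.+ t) C k) * multinomial ks * (ℕtoℚ (k !) * ℕtoℚ (prodFact ks))
      ≡⟨ cong (ℕtoℚ ((k ℕ.+ t) C k) * multinomial ks *_) (ℕtoℚ-homo-* (k !) (prodFact ks)) ⟨
    ℕtoℚ ((k ℕ.+ t) C k) * multinomial ks * ℕtoℚ (k ! ℕ.* prodFact ks) ∎)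
    where
    open ≡-Reasoning
    t = total ks
    regroup : ∀ a b c d → a * (b * (c * d)) ≡ a * c * (b * d)
    regroup = solve-∀ ℚ-ring

  monomial : ℕ → ℚ → Series
  monomial j c i = δ i j * c

  monomial-⊛ : ∀ j c z r → (monomial j c ⊛ z) r ≡ δ≤ j r * (c * z (r ∸ j))
  monomial-⊛ j c z r with j ℕₚ.≤? r
  ... | yes j≤r = begin
    ∑[ i < suc r ] (δ i j * c * z (r ∸ i))   ≡⟨ ∑-cong (suc r) (λ i _ → *-assoc (δ i j) c (z (r ∸ i))) ⟩
    ∑[ i < suc r ] (δ i j * (c * z (r ∸ i))) ≡⟨ ∑-δ (suc r) (λ i → c * z (r ∸ i)) (s≤s j≤r) ⟩
    c * z (r ∸ j)                            ≡⟨ *-identityˡ (c * z (r ∸ j)) ⟨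
    1ℚ * (c * z (r ∸ j))                     ≡⟨ cong (_* (c * z (r ∸ j))) (δ≤-yes j≤r) ⟨
    δ≤ j r * (c * z (r ∸ j))                 ∎
    where open ≡-Reasoning
  ... | no j≰r = begin
    ∑[ i < suc r ] (δ i j * c * z (r ∸ i))   ≡⟨ ∑-zero (suc r) off-diagonal ⟩
    0ℚ                                       ≡⟨ *-zeroˡ (c * z (r ∸ j)) ⟨
    0ℚ * (c * z (r ∸ j))                     ≡⟨ cong (_* (c * z (r ∸ j))) (δ≤-no (ℕₚ.≰⇒> j≰r)) ⟨
    δ≤ j r * (c * z (r ∸ j))                 ∎
    where
    open ≡-Reasoning
    off-diagonal : ∀ i → i < suc r → δ i j * c * z (r ∸ i) ≡ 0ℚ
    off-diagonal i i<1+r rewrite δ-≢ {i} {j} (λ { refl → j≰r (ℕₚ.≤-pred i<1+r) }) =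
      trans (cong (_* z (r ∸ i)) (*-zeroˡ c)) (*-zeroˡ (z (r ∸ i)))

  monomial-^-⊛ : ∀ j c k z r → ((monomial j c ^ k) ⊛ z) r ≡ δ≤ (j ℕ.* k) r * (c ^ℚ k * z (r ∸ j ℕ.* k))
  monomial-^-⊛ j c zero z r rewrite ℕₚ.*-zeroʳ j =
    trans (𝟙-identityˡ z r) (sym (trans (*-identityˡ (1ℚ * z r)) (*-identityˡ (z r))))
  monomial-^-⊛ j c (suc k) z r = begin
    ((monomial j c ⊛ monomial j c ^ k) ⊛ z) r
      ≡⟨ ⊛-assoc (monomial j c) (monomial j c ^ k) z r ⟩
    (monomial j c ⊛ (monomial j c ^ k ⊛ z)) r
      ≡⟨ monomial-⊛ j c (monomial j c ^ k ⊛ z) r ⟩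
    δ≤ j r * (c * (monomial j c ^ k ⊛ z) (r ∸ j))
      ≡⟨ cong (λ q → δ≤ j r * (c * q)) (monomial-^-⊛ j c k z (r ∸ j)) ⟩
    δ≤ j r * (c * (δ≤ (j ℕ.* k) (r ∸ j) * (c ^ℚ k * z (r ∸ j ∸ j ℕ.* k))))
      ≡⟨ regroup (δ≤ j r) c (δ≤ (j ℕ.* k) (r ∸ j)) (c ^ℚ k) (z (r ∸ j ∸ j ℕ.* k)) ⟩
    δ≤ j r * δ≤ (j ℕ.* k) (r ∸ j) * (c ^ℚ suc k * z (r ∸ j ∸ j ℕ.* k))
      ≡⟨ cong₂ (λ p q → p * (c ^ℚ suc k * z q)) (δ≤-+ j (j ℕ.* k) r) (ℕₚ.∸-+-assoc r j (j ℕ.* k)) ⟩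
    δ≤ (j ℕ.+ j ℕ.* k) r * (c ^ℚ suc k * z (r ∸ (j ℕ.+ j ℕ.* k)))
      ≡⟨ cong (λ i → δ≤ i r * (c ^ℚ suc k * z (r ∸ i))) (ℕₚ.*-suc j k) ⟨
    δ≤ (j ℕ.* suc k) r * (c ^ℚ suc k * z (r ∸ j ℕ.* suc k)) ∎
    where
    open ≡-Reasoning
    regroup : ∀ a b d e f → a * (b * (d * (e * f))) ≡ a * d * (b * e * f)
    regroup = solve-∀ ℚ-ring

  module _ (b : ℕ → ℚ) where

    window : ℕ → ℕ → Series
    window ℓ zero    = 𝟘
    window ℓ (suc m) = monomial ℓ (b ℓ) ⊕ window (suc ℓ) m

    multinomial-term : ℕ → ℕ → ℕ → ∀ {m} → Vec ℕ m → ℚ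
    multinomial-term ℓ r n ks = δ (weighted ℓ ks) r * (δ (total ks) n * (multinomial ks * prodPow b ℓ ks))

    binomial-factor : ℕ → ℕ → ℕ → ℕ → ℚ
    binomial-factor ℓ r n k = δ≤ (ℓ ℕ.* k) r * (δ≤ k n * (ℕtoℚ (n C k) * b ℓ ^ℚ k))

    multinomial-term-∷ : ∀ ℓ r n k {m} (ks : Vec ℕ m) →
      multinomial-term ℓ r n (k ∷ ks) ≡ binomial-factor ℓ r n k * multinomial-term (suc ℓ) (r ∸ ℓ ℕ.* k) (n ∸ k) ks
    multinomial-term-∷ ℓ r n k ks = begin
      δ (ℓ ℕ.* k ℕ.+ w) r * (δ (k ℕ.+ t) n * (multinomial (k ∷ ks) * (bᵏ * P)))
        ≡⟨ cong₂ (λ p q → p * (δ (k ℕ.+ t) n * (q * (bᵏ * P)))) (δ-+ (ℓ ℕ.* k) w r) (multinomial-∷ k ks) ⟩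
      δ≤ (ℓ ℕ.* k) r * δ w (r ∸ ℓ ℕ.* k) * (δ (k ℕ.+ t) n * (ℕtoℚ ((k ℕ.+ t) C k) * M * (bᵏ * P)))
        ≡⟨ cong (δ≤ (ℓ ℕ.* k) r * δ w (r ∸ ℓ ℕ.* k) *_) (regroup₁ (δ (k ℕ.+ t) n) (ℕtoℚ ((k ℕ.+ t) C k)) M (bᵏ * P)) ⟩
      δ≤ (ℓ ℕ.* k) r * δ w (r ∸ ℓ ℕ.* k) * (δ (k ℕ.+ t) n * ℕtoℚ ((k ℕ.+ t) C k) * (M * (bᵏ * P)))
        ≡⟨ cong (λ q → δ≤ (ℓ ℕ.* k) r * δ w (r ∸ ℓ ℕ.* k) * (q * (M * (bᵏ * P)))) (δ-+-binomial k t n) ⟩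
      δ≤ (ℓ ℕ.* k) r * δ w (r ∸ ℓ ℕ.* k) * (δ≤ k n * (ℕtoℚ (n C k) * δ t (n ∸ k)) * (M * (bᵏ * P)))
        ≡⟨ regroup₂ (δ≤ (ℓ ℕ.* k) r) (δ w (r ∸ ℓ ℕ.* k)) (δ≤ k n) (ℕtoℚ (n C k)) (δ t (n ∸ k)) M bᵏ P ⟩
      binomial-factor ℓ r n k * multinomial-term (suc ℓ) (r ∸ ℓ ℕ.* k) (n ∸ k) ks ∎
      where
      open ≡-Reasoning
      w = weighted (suc ℓ) ks
      t = total ks
      M = multinomial ks
      bᵏ = b ℓ ^ℚ k
      P = prodPow b (suc ℓ) ks
      regroup₁ : ∀ d c m q → d * (c * m * q) ≡ d * c * (m * q)
      regroup₁ = solve-∀ ℚ-ring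
      regroup₂ : ∀ a d g c e m x p → a * d * (g * (c * e) * (m * (x * p))) ≡ a * (g * (c * x)) * (d * (e * (m * p)))
      regroup₂ = solve-∀ ℚ-ring

    binomial-factor-vanishes : ∀ ℓ r {n k} → n < k → binomial-factor ℓ r n k ≡ 0ℚ
    binomial-factor-vanishes ℓ r {n} {k} n<k rewrite δ≤-no n<k =
      trans (cong (δ≤ (ℓ ℕ.* k) r *_) (*-zeroˡ (ℕtoℚ (n C k) * b ℓ ^ℚ k))) (*-zeroʳ (δ≤ (ℓ ℕ.* k) r))

    binomial-factor-⊛ : ∀ ℓ r {n k} (w : Series) → k ≤ n →
      binomial-factor ℓ r n k * (w ^ (n ∸ k)) (r ∸ ℓ ℕ.* k) ≡ ℕtoℚ (n C k) * ((monomial ℓ (b ℓ) ^ k) ⊛ (w ^ (n ∸ k))) r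
    binomial-factor-⊛ ℓ r {n} {k} w k≤n rewrite δ≤-yes k≤n | monomial-^-⊛ ℓ (b ℓ) k (w ^ (n ∸ k)) r =
      regroup (δ≤ (ℓ ℕ.* k) r) (ℕtoℚ (n C k)) (b ℓ ^ℚ k) ((w ^ (n ∸ k)) (r ∸ ℓ ℕ.* k))
      where
      regroup : ∀ d c x y → d * (1ℚ * (c * x)) * y ≡ c * (d * (x * y))
      regroup = solve-∀ ℚ-ring

    multinomial-theorem : ∀ m ℓ r {n N} → n < N → boxSum m N (multinomial-term ℓ r n) ≡ (window ℓ m ^ n) r
    multinomial-theorem zero ℓ zero    {zero}  _ = refl
    multinomial-theorem zero ℓ (suc r) {zero}  _ = refl
    multinomial-theorem zero ℓ r       {suc n} _ =
      trans (+-identityʳ _) (trans (*-zeroʳ (δ 0 r)) (sym (𝟘^suc n r)))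
    multinomial-theorem (suc m) ℓ r {n} {N} n<N = begin
      boxSum (suc m) N (multinomial-term ℓ r n)
        ≡⟨ boxSum-suc m N (multinomial-term ℓ r n) ⟩
      ∑[ k < N ] boxSum m N (λ ks → multinomial-term ℓ r n (k ∷ ks))
        ≡⟨ ∑-cong N (λ k _ → peel k) ⟩
      ∑[ k < N ] (binomial-factor ℓ r n k * (W ^ (n ∸ k)) (r ∸ ℓ ℕ.* k))
        ≡⟨ ∑-truncate n<N (λ k n<k → trans (cong (_* (W ^ (n ∸ k)) (r ∸ ℓ ℕ.* k)) (binomial-factor-vanishes ℓ r n<k))
                                           (*-zeroˡ ((W ^ (n ∸ k)) (r ∸ ℓ ℕ.* k)))) ⟩
      ∑[ k < suc n ] (binomial-factor ℓ r n k * (W ^ (n ∸ k)) (r ∸ ℓ ℕ.* k))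
        ≡⟨ ∑-cong (suc n) (λ k k<1+n → binomial-factor-⊛ ℓ r W (ℕₚ.≤-pred k<1+n)) ⟩
      ∑[ k < suc n ] (ℕtoℚ (n C k) * ((monomial ℓ (b ℓ) ^ k) ⊛ (W ^ (n ∸ k))) r)
        ≡⟨ ^-binomial (monomial ℓ (b ℓ)) W n r ⟨
      (window ℓ (suc m) ^ n) r ∎
      where
      open ≡-Reasoning
      W = window (suc ℓ) m
      peel : ∀ k → boxSum m N (λ ks → multinomial-term ℓ r n (k ∷ ks))
                   ≡ binomial-factor ℓ r n k * (W ^ (n ∸ k)) (r ∸ ℓ ℕ.* k)
      peel k = begin
        boxSum m N (λ ks → multinomial-term ℓ r n (k ∷ ks))
          ≡⟨ boxSum-cong m N (multinomial-term-∷ ℓ r n k) ⟩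
        boxSum m N (λ ks → binomial-factor ℓ r n k * multinomial-term (suc ℓ) (r ∸ ℓ ℕ.* k) (n ∸ k) ks)
          ≡⟨ boxSum-distribˡ m N (binomial-factor ℓ r n k) (multinomial-term (suc ℓ) (r ∸ ℓ ℕ.* k) (n ∸ k)) ⟨
        binomial-factor ℓ r n k * boxSum m N (multinomial-term (suc ℓ) (r ∸ ℓ ℕ.* k) (n ∸ k))
          ≡⟨ cong (binomial-factor ℓ r n k *_)
                  (multinomial-theorem m (suc ℓ) (r ∸ ℓ ℕ.* k) (ℕₚ.≤-<-trans (ℕₚ.m∸n≤m n k) n<N)) ⟩
        binomial-factor ℓ r n k * (W ^ (n ∸ k)) (r ∸ ℓ ℕ.* k) ∎

    window-below : ∀ m ℓ i → i < ℓ → window ℓ m i ≡ 0ℚ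
    window-below zero    ℓ i _   = refl
    window-below (suc m) ℓ i i<ℓ =
      trans (cong₂ _+_ (trans (cong (_* b ℓ) (δ-≢ (ℕₚ.<⇒≢ i<ℓ))) (*-zeroˡ (b ℓ)))
                       (window-below m (suc ℓ) i (ℕₚ.m<n⇒m<1+n i<ℓ)))
            (+-identityˡ 0ℚ)

    window-inside : ∀ m ℓ i → ℓ ≤ i → i < ℓ ℕ.+ m → window ℓ m i ≡ b i
    window-inside zero    ℓ i ℓ≤i i<ℓ+0 = ⊥-elim (ℕₚ.<-irrefl refl (ℕₚ.<-≤-trans (subst (i <_) (ℕₚ.+-identityʳ ℓ) i<ℓ+0) ℓ≤i))
    window-inside (suc m) ℓ i ℓ≤i i<ℓ+1+m with i ℕₚ.≟ ℓ
    ... | yes refl = trans (cong₂ _+_ (trans (cong (_* b i) (δ-refl i)) (*-identityˡ (b i)))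
                                      (window-below m (suc i) i ℕₚ.≤-refl))
                           (+-identityʳ (b i))
    ... | no i≢ℓ   = trans (cong₂ _+_ (trans (cong (_* b ℓ) (δ-≢ i≢ℓ)) (*-zeroˡ (b ℓ)))
                                      (window-inside m (suc ℓ) i (ℕₚ.≤∧≢⇒< ℓ≤i (i≢ℓ ∘ sym))
                                                     (subst (i <_) (ℕₚ.+-suc ℓ m) i<ℓ+1+m)))
                           (+-identityˡ (b i))

    window-≈[≤] : ∀ h (Q : Series) → Q 0 ≡ 0ℚ → (∀ j → suc j ≤ h → Q (suc j) ≡ b (suc j)) → window 1 h ≈[≤ h ] Q
    window-≈[≤] h Q Q₀≡0 Q≡b zero    _     = trans (window-below h 1 0 (s≤s z≤n)) (sym Q₀≡0)
    window-≈[≤] h Q Q₀≡0 Q≡b (suc j) 1+j≤h = trans (window-inside h 1 (suc j) (s≤s z≤n) (s≤s 1+j≤h)) (sym (Q≡b j 1+j≤h))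

  total≤weighted : ∀ {m} ℓ (ks : Vec ℕ m) → 1 ≤ ℓ → total ks ≤ weighted ℓ ks
  total≤weighted ℓ       []       _ = z≤n
  total≤weighted (suc ℓ) (k ∷ ks) _ = ℕₚ.+-mono-≤ (ℕₚ.m≤n*m k (suc ℓ)) (total≤weighted (suc (suc ℓ)) ks (s≤s z≤n))

  total≰⇒weighted≢ : ∀ {m h} (ks : Vec ℕ m) → ¬ total ks ≤ h → weighted 1 ks ≢ h
  total≰⇒weighted≢ ks t≰h w≡h = t≰h (subst (total ks ≤_) w≡h (total≤weighted 1 ks (s≤s z≤n)))

  if-then-0 : ∀ c q → (if c then q else 0ℚ) ≡ (if c then 1ℚ else 0ℚ) * q
  if-then-0 true  q = sym (*-identityˡ q)
  if-then-0 false q = sym (*-zeroˡ q)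

  tupleSum : ℕ → (ℕ → ℚ) → ℚ
  tupleSum g b = sumℚ (map (λ ks → multinomial ks * (ℕtoℚ (total ks) + 1ℚ) * prodPow b 1 ks) (tuples g))

  tupleSum-term : ∀ h b (ks : Vec ℕ h) →
    δ (weighted 1 ks) h * (multinomial ks * (ℕtoℚ (total ks) + 1ℚ) * prodPow b 1 ks)
      ≡ ∑[ n < suc h ] (ℕtoℚ (suc n) * multinomial-term b 1 h n ks)
  tupleSum-term h b ks with total ks ℕₚ.≤? h
  ... | yes t≤h = begin
    δ w h * (M * (ℕtoℚ t + 1ℚ) * P)                ≡⟨ regroup (δ w h) M (ℕtoℚ t) P ⟩
    (1ℚ + ℕtoℚ t) * (δ w h * (M * P))              ≡⟨ cong (_* (δ w h * (M * P))) (ℕtoℚ-suc t) ⟨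
    ℕtoℚ (suc t) * (δ w h * (M * P))               ≡⟨ ∑-δ (suc h) (λ n → ℕtoℚ (suc n) * (δ w h * (M * P))) (s≤s t≤h) ⟨
    ∑[ n < suc h ] (δ n t * (ℕtoℚ (suc n) * (δ w h * (M * P))))
      ≡⟨ ∑-cong (suc h) (λ n _ → trans (cong (_* (ℕtoℚ (suc n) * (δ w h * (M * P)))) (δ-sym n t))
                                       (regroup′ (δ t n) (ℕtoℚ (suc n)) (δ w h) (M * P))) ⟩
    ∑[ n < suc h ] (ℕtoℚ (suc n) * (δ w h * (δ t n * (M * P)))) ∎
    where
    open ≡-Reasoning
    w = weighted 1 ks
    t = total ks
    M = multinomial ks
    P = prodPow b 1 ks
    regroup : ∀ d m x p → d * (m * (x + 1ℚ) * p) ≡ (1ℚ + x) * (d * (m * p))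
    regroup = solve-∀ ℚ-ring
    regroup′ : ∀ e x d q → e * (x * (d * q)) ≡ x * (d * (e * q))
    regroup′ = solve-∀ ℚ-ring
  ... | no t≰h rewrite δ-≢ (total≰⇒weighted≢ ks t≰h) =
    trans (*-zeroˡ (multinomial ks * (ℕtoℚ (total ks) + 1ℚ) * prodPow b 1 ks))
          (sym (∑-zero (suc h) (λ n _ → vanish (ℕtoℚ (suc n)) (δ (total ks) n * (multinomial ks * prodPow b 1 ks)))))
    where
    vanish : ∀ x q → x * (0ℚ * q) ≡ 0ℚ
    vanish = solve-∀ ℚ-ring

  tupleSum-∑ : ∀ h b (Q : Series) → Q 0 ≡ 0ℚ → (∀ j → suc j ≤ h → Q (suc j) ≡ b (suc j)) →
               tupleSum (suc h) b ≡ ∑[ n < suc h ] (ℕtoℚ (suc n) * (Q ^ n) h)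
  tupleSum-∑ h b Q Q₀≡0 Q≡b = begin
    tupleSum (suc h) b
      ≡⟨ sumℚ-filter (λ ks → weighted 1 ks ℕₚ.≟ h) F (box h (suc h)) ⟩
    sumℚ (map (λ ks → if weighted 1 ks ≡ᵇ h then F ks else 0ℚ) (box h (suc h)))
      ≡⟨ sumℚ-cong (box h (suc h)) (λ ks → trans (if-then-0 (weighted 1 ks ≡ᵇ h) (F ks)) (tupleSum-term h b ks)) ⟩
    sumℚ (map (λ ks → ∑[ n < suc h ] (ℕtoℚ (suc n) * multinomial-term b 1 h n ks)) (box h (suc h)))
      ≡⟨ sumℚ-∑ (suc h) (λ ks n → ℕtoℚ (suc n) * multinomial-term b 1 h n ks) (box h (suc h)) ⟩
    ∑[ n < suc h ] sumℚ (map (λ ks → ℕtoℚ (suc n) * multinomial-term b 1 h n ks) (box h (suc h)))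
      ≡⟨ ∑-cong (suc h) (λ n n<1+h → trans (sym (boxSum-distribˡ h (suc h) (ℕtoℚ (suc n)) (multinomial-term b 1 h n)))
                                            (cong (ℕtoℚ (suc n) *_) (multinomial-theorem b h 1 h n<1+h))) ⟩
    ∑[ n < suc h ] (ℕtoℚ (suc n) * (window b 1 h ^ n) h)
      ≡⟨ ∑-cong (suc h) (λ n _ → cong (ℕtoℚ (suc n) *_) (≈[≤]-^ n (window-≈[≤] b h Q Q₀≡0 Q≡b) h ℕₚ.≤-refl)) ⟩
    ∑[ n < suc h ] (ℕtoℚ (suc n) * (Q ^ n) h) ∎
    where
    open ≡-Reasoning
    F : Vec ℕ h → ℚ
    F ks = multinomial ks * (ℕtoℚ (total ks) + 1ℚ) * prodPow b 1 ks

  -- The generating function of β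

  βUpTo≡β : ∀ n ℓ → 1 ≤ ℓ → ℓ ≤ n → βUpTo n ℓ ≡ β ℓ
  βUpTo≡β (suc zero)    (suc zero)    _   _   = refl
  βUpTo≡β (suc zero)    (suc (suc ℓ)) _   (s≤s ())
  βUpTo≡β (suc (suc n)) ℓ             1≤ℓ ℓ≤2+n = by-cases (ℓ ℕₚ.≟ 2 ℕ.+ n) (βUpTo≡β (suc n) ℓ 1≤ℓ)
    where
    by-cases : Dec (ℓ ≡ 2 ℕ.+ n) → (ℓ ≤ suc n → βUpTo (suc n) ℓ ≡ β ℓ) → βUpTo (2 ℕ.+ n) ℓ ≡ β ℓ
    by-cases (yes ℓ≡2+n) _ = cong (λ i → βUpTo i ℓ) (sym ℓ≡2+n)
    by-cases (no ℓ≢2+n) below rewrite ≢⇒≡ᵇ-false ℓ (2 ℕ.+ n) ℓ≢2+n = below (ℕₚ.≤-pred (ℕₚ.≤∧≢⇒< ℓ≤2+n ℓ≢2+n))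

  β-unfold : ∀ k → β (2 ℕ.+ k) ≡ step (2 ℕ.+ k) (βUpTo (suc k))
  β-unfold k rewrite ≡ᵇ-refl k = refl

  βSeries : Series
  βSeries zero    = 0ℚ
  βSeries (suc i) = β (suc i)

  βUpTo≡βSeries : ∀ k i → i ≤ k → βUpTo (suc k) (suc i) ≡ βSeries (suc i)
  βUpTo≡βSeries k i i≤k = βUpTo≡β (suc k) (suc i) (s≤s z≤n) (s≤s i≤k)

  convolutionSum-βUpTo : ∀ k → sumℚ (map (λ ℓ → βUpTo (suc k) ℓ * βUpTo (suc k) (2 ℕ.+ k ∸ ℓ)) (map suc (upTo (suc k))))
                             ≡ (βSeries ⊛ βSeries) (2 ℕ.+ k)
  convolutionSum-βUpTo k = begin
    sumℚ (map f (map suc (upTo (suc k))))  ≡⟨ cong sumℚ (map-∘ {g = f} {f = suc} (upTo (suc k))) ⟨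
    sumℚ (map (f ∘ suc) (upTo (suc k)))    ≡⟨ sumℚ-upTo (suc k) (f ∘ suc) ⟩
    ∑[ j < suc k ] f (suc j)               ≡⟨ ∑-cong (suc k) (λ j j<1+k → cong₂ _*_ (βUpTo≡βSeries k j (ℕₚ.≤-pred j<1+k))
                                                                              (second-factor j (ℕₚ.≤-pred j<1+k))) ⟩
    ∑[ j < suc k ] (βSeries (suc j) * βSeries (suc k ∸ j)) ≡⟨ ⊛-suc-without-constants βSeries βSeries refl refl (suc k) ⟨
    (βSeries ⊛ βSeries) (2 ℕ.+ k)          ∎
    where
    open ≡-Reasoning
    f : ℕ → ℚ
    f ℓ = βUpTo (suc k) ℓ * βUpTo (suc k) (2 ℕ.+ k ∸ ℓ)
    second-factor : ∀ j → j ≤ k → βUpTo (suc k) (suc k ∸ j) ≡ βSeries (suc k ∸ j)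
    second-factor j j≤k rewrite ℕₚ.+-∸-assoc 1 j≤k = βUpTo≡βSeries k (k ∸ j) (ℕₚ.m∸n≤m k j)

  -- Partial sums of (1 - B)⁻².
  geometric′ : Series → ℕ → Series
  geometric′ B N r = ∑[ n < N ] (ℕtoℚ (suc n) * (B ^ n) r)

  const-ℕtoℚ-suc : ∀ N → const (ℕtoℚ (suc N)) ≈ 𝟙 ⊕ const (ℕtoℚ N)
  const-ℕtoℚ-suc N = ≈-trans (λ r → cong (λ q → const q r) (ℕtoℚ-suc N)) (const-homo-+ 1ℚ (ℕtoℚ N))

  geometric′-telescopes : ∀ B N → geometric′ B N ⊛ ((𝟙 ⊕ ⊖ B) ⊛ (𝟙 ⊕ ⊖ B))
                                   ≈ 𝟙 ⊕ ⊖ (const (ℕtoℚ (suc N)) ⊛ B ^ N) ⊕ const (ℕtoℚ N) ⊛ B ^ suc N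
  geometric′-telescopes B zero = begin
    geometric′ B 0 ⊛ Q                        ≈⟨ (λ r → ∑-zero (suc r) (λ i _ → *-zeroˡ (Q (r ∸ i)))) ⟩
    𝟘                                         ≈⟨ (λ { zero → refl ; (suc r) → refl }) ⟩
    const 0ℚ                                  ≈⟨ solve 1 (λ b → con 0ℚ := con 1ℚ :+ :- (con 1ℚ :* con 1ℚ) :+ con 0ℚ :* (b :* con 1ℚ))
                                                           ≈-refl B ⟩
    𝟙 ⊕ ⊖ (const 1ℚ ⊛ 𝟙) ⊕ const 0ℚ ⊛ (B ⊛ 𝟙) ∎
    where
    open ≈-Reasoning
    Q = (𝟙 ⊕ ⊖ B) ⊛ (𝟙 ⊕ ⊖ B)
  geometric′-telescopes B (suc N) = begin
    geometric′ B (suc N) ⊛ Q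
      ≈⟨ ⊛-congʳ Q split-last ⟩
    (geometric′ B N ⊕ c₁ ⊛ P) ⊛ Q
      ≈⟨ ⊛-distribʳ Q (geometric′ B N) (c₁ ⊛ P) ⟩
    geometric′ B N ⊛ Q ⊕ c₁ ⊛ P ⊛ Q
      ≈⟨ ⊕-congʳ (c₁ ⊛ P ⊛ Q) (geometric′-telescopes B N) ⟩
    𝟙 ⊕ ⊖ (c₁ ⊛ P) ⊕ c₀ ⊛ (B ⊛ P) ⊕ c₁ ⊛ P ⊛ Q
      ≈⟨ ⊕-cong (⊕-congʳ (c₀ ⊛ (B ⊛ P)) (⊕-congˡ 𝟙 (⊖-cong c₁P≈))) (⊛-congʳ Q c₁P≈) ⟩
    𝟙 ⊕ ⊖ ((𝟙 ⊕ c₀) ⊛ P) ⊕ c₀ ⊛ (B ⊛ P) ⊕ (𝟙 ⊕ c₀) ⊛ P ⊛ Q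
      ≈⟨ solve 3 (λ c p b → con 1ℚ :+ :- ((con 1ℚ :+ c) :* p) :+ c :* (b :* p) :+ (con 1ℚ :+ c) :* p :* ((con 1ℚ :+ :- b) :* (con 1ℚ :+ :- b))
                          := con 1ℚ :+ :- ((con 1ℚ :+ (con 1ℚ :+ c)) :* (b :* p)) :+ (con 1ℚ :+ c) :* (b :* (b :* p)))
                  ≈-refl c₀ P B ⟩
    𝟙 ⊕ ⊖ ((𝟙 ⊕ (𝟙 ⊕ c₀)) ⊛ B ^ suc N) ⊕ (𝟙 ⊕ c₀) ⊛ B ^ suc (suc N)
      ≈⟨ ⊕-cong (⊕-congˡ 𝟙 (⊖-cong (⊛-congʳ (B ^ suc N) c₂≈)))
                (⊛-congʳ (B ^ suc (suc N)) (≈-sym (const-ℕtoℚ-suc N))) ⟩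
    𝟙 ⊕ ⊖ (c₂ ⊛ B ^ suc N) ⊕ c₁ ⊛ B ^ suc (suc N) ∎
    where
    open ≈-Reasoning
    Q  = (𝟙 ⊕ ⊖ B) ⊛ (𝟙 ⊕ ⊖ B)
    P  = B ^ N
    c₀ = const (ℕtoℚ N)
    c₁ = const (ℕtoℚ (suc N))
    c₂ = const (ℕtoℚ (2 ℕ.+ N))
    split-last : geometric′ B (suc N) ≈ geometric′ B N ⊕ c₁ ⊛ P
    split-last r = trans (∑-init-last N (λ n → ℕtoℚ (suc n) * (B ^ n) r))
                         (cong (geometric′ B N r +_) (sym (const-⊛ (ℕtoℚ (suc N)) P r)))
    c₁P≈ : c₁ ⊛ P ≈ (𝟙 ⊕ c₀) ⊛ P
    c₁P≈ = ⊛-congʳ P (const-ℕtoℚ-suc N)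
    c₂≈ : 𝟙 ⊕ (𝟙 ⊕ c₀) ≈ c₂
    c₂≈ = ≈-sym (≈-trans (const-ℕtoℚ-suc (suc N)) (⊕-congˡ 𝟙 (const-ℕtoℚ-suc N)))

  X^1∣βSeries : X^ 1 ∣ βSeries
  X^1∣βSeries zero    _         = refl
  X^1∣βSeries (suc i) (s≤s ())

  β-recursion-coeff : ∀ h → (const (ℕtoℚ 2) ⊛ βSeries ⊕ ⊖ (βSeries ⊛ βSeries)) (suc h) ≡ geometric′ βSeries (suc h) h
  β-recursion-coeff zero    = refl
  β-recursion-coeff (suc k) = begin
    (const (ℕtoℚ 2) ⊛ βSeries) (2 ℕ.+ k) + - β²
      ≡⟨ cong (_+ - β²) (trans (const-⊛ (ℕtoℚ 2) βSeries (2 ℕ.+ k)) (cong (ℕtoℚ 2 *_) (β-unfold k))) ⟩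
    ℕtoℚ 2 * (½ * convolutionSum + ½ * tupleSum (2 ℕ.+ k) (βUpTo (suc k))) + - β²
      ≡⟨ cong₂ (λ p q → ℕtoℚ 2 * (½ * p + ½ * q) + - β²)
               (convolutionSum-βUpTo k)
               (tupleSum-∑ (suc k) (βUpTo (suc k)) βSeries refl (λ j 1+j≤1+k → sym (βUpTo≡βSeries k j (ℕₚ.≤-pred 1+j≤1+k)))) ⟩
    ℕtoℚ 2 * (½ * β² + ½ * geometric′ βSeries (2 ℕ.+ k) (suc k)) + - β²
      ≡⟨ halves β² (geometric′ βSeries (2 ℕ.+ k) (suc k)) ⟩
    geometric′ βSeries (2 ℕ.+ k) (suc k) ∎
    where
    open ≡-Reasoning
    β² = (βSeries ⊛ βSeries) (2 ℕ.+ k)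
    convolutionSum = sumℚ (map (λ ℓ → βUpTo (suc k) ℓ * βUpTo (suc k) (2 ℕ.+ k ∸ ℓ)) (map suc (upTo (suc k))))
    halves : ∀ s t → ℕtoℚ 2 * (½ * s + ½ * t) + - s ≡ t
    halves = solve-∀ ℚ-ring

  geometric′-stable : ∀ B → X^ 1 ∣ B → ∀ {N r} → r < N → geometric′ B N r ≡ geometric′ B (suc r) r
  geometric′-stable B X∣B r<N =
    ∑-truncate r<N (λ n r<n → trans (cong (ℕtoℚ (suc n) *_) (X^∣-^ X∣B n _ r<n)) (*-zeroʳ (ℕtoℚ (suc n))))

  β-equation : (const (ℕtoℚ 2) ⊛ βSeries ⊕ ⊖ (βSeries ⊛ βSeries)) ⊛ ((𝟙 ⊕ ⊖ βSeries) ⊛ (𝟙 ⊕ ⊖ βSeries)) ≈ X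
  β-equation zero    = refl
  β-equation (suc h) = begin
    (Y ⊛ Q) (suc h)                      ≡⟨ ≈[≤]-⊛ {suc h} {Y} {X ⊛ G} {Q} {Q} Y≈XG (λ _ _ → refl) (suc h) ℕₚ.≤-refl ⟩
    ((X ⊛ G) ⊛ Q) (suc h)                ≡⟨ ⊛-assoc X G Q (suc h) ⟩
    (X ⊛ (G ⊛ Q)) (suc h)                ≡⟨ X-⊛-suc (G ⊛ Q) h ⟩
    (G ⊛ Q) h                            ≡⟨ geometric′-telescopes βSeries (suc h) h ⟩
    𝟙 h + - (c₂ ⊛ βSeries ^ suc h) h + (c₁ ⊛ βSeries ^ suc (suc h)) h
      ≡⟨ cong₂ (λ p q → 𝟙 h + - p + q) (vanishes (ℕtoℚ (2 ℕ.+ h)) (suc h) ℕₚ.≤-refl) (vanishes (ℕtoℚ (suc h)) (2 ℕ.+ h) (ℕₚ.m<n⇒m<1+n ℕₚ.≤-refl)) ⟩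
    𝟙 h + - 0ℚ + 0ℚ                      ≡⟨ +-identityʳ (𝟙 h + - 0ℚ) ⟩
    𝟙 h + 0ℚ                             ≡⟨ +-identityʳ (𝟙 h) ⟩
    𝟙 h                                  ≡⟨ 𝟙≡tail-X h ⟩
    X (suc h)                            ∎
    where
    open ≡-Reasoning
    Y = const (ℕtoℚ 2) ⊛ βSeries ⊕ ⊖ (βSeries ⊛ βSeries)
    Q = (𝟙 ⊕ ⊖ βSeries) ⊛ (𝟙 ⊕ ⊖ βSeries)
    G = geometric′ βSeries (suc h)
    c₁ = const (ℕtoℚ (suc h))
    c₂ = const (ℕtoℚ (2 ℕ.+ h))
    Y≈XG : Y ≈[≤ suc h ] X ⊛ G
    Y≈XG zero    _       = sym (trans (+-identityʳ _) (*-zeroˡ (G 0)))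
    Y≈XG (suc j) 1+j≤1+h = trans (β-recursion-coeff j)
      (trans (sym (geometric′-stable βSeries X^1∣βSeries 1+j≤1+h)) (sym (X-⊛-suc G j)))
    𝟙≡tail-X : ∀ h → 𝟙 h ≡ X (suc h)
    𝟙≡tail-X zero    = refl
    𝟙≡tail-X (suc h) = refl
    vanishes : ∀ c n → h < n → (const c ⊛ βSeries ^ n) h ≡ 0ℚ
    vanishes c n h<n = trans (const-⊛ c (βSeries ^ n) h) (trans (cong (c *_) (X^∣-^ X^1∣βSeries n h h<n)) (*-zeroʳ c))

  β-hypergeometric : hypergeometric (𝟙 ⊕ ⊖ βSeries) ≈ 𝟘
  β-hypergeometric = quartic⇒hypergeometric U refl (≈-trans expand-in-B β-equation)
    where
    U = 𝟙 ⊕ ⊖ βSeries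
    expand-in-B : U ⊛ U ⊛ (𝟙 ⊕ ⊖ (U ⊛ U)) ≈ (const (ℕtoℚ 2) ⊛ βSeries ⊕ ⊖ (βSeries ⊛ βSeries)) ⊛ (U ⊛ U)
    expand-in-B = solve 1 (λ b → let u = con 1ℚ :+ :- b in
                           u :* u :* (con 1ℚ :+ :- (u :* u)) := (con (ℕtoℚ 2) :* b :+ :- (b :* b)) :* (u :* u))
                         ≈-refl βSeries

  β-recurrence : ∀ h → leading h * β (2 ℕ.+ h) ≡ trailing h * β (suc h)
  β-recurrence h = begin
    leading h * β (2 ℕ.+ h)                 ≡⟨ negate-twice (leading h) (β (2 ℕ.+ h)) ⟩
    - (leading h * (0ℚ + - β (2 ℕ.+ h)))    ≡⟨ cong -_ (hypergeometric-recurrence (𝟙 ⊕ ⊖ βSeries) β-hypergeometric h) ⟩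
    - (trailing h * (0ℚ + - β (suc h)))     ≡⟨ negate-twice (trailing h) (β (suc h)) ⟨
    trailing h * β (suc h)                  ∎
    where
    open ≡-Reasoning
    negate-twice : ∀ c x → c * x ≡ - (c * (0ℚ + - x))
    negate-twice = solve-∀ ℚ-ring

  -- Catalan numbers

  central-binomial-suc : ∀ m → suc m ℕ.* (2 ℕ.* suc m C suc m) ≡ 2 ℕ.* (2 ℕ.* m ℕ.+ 1) ℕ.* (2 ℕ.* m C m)
  central-binomial-suc m = ℕₚ.*-cancelʳ-≡ _ _ (suc m ℕ.* (m ! ℕ.* m !)) {{m+1*m!*m!≢0}} (begin
    suc m ℕ.* c′ ℕ.* (suc m ℕ.* (m ! ℕ.* m !))       ≡⟨ regroup (suc m) c′ (m !) ⟩
    c′ ℕ.* (suc m ! ℕ.* suc m !)                    ≡⟨ cong (λ j → c′ ℕ.* (suc m ! ℕ.* j !)) (2n∸n≡n (suc m)) ⟨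
    c′ ℕ.* (suc m ! ℕ.* (2 ℕ.* suc m ∸ suc m) !)    ≡⟨ nCk*k!*[n∸k]!≡n! (ℕₚ.m≤n*m (suc m) 2) ⟩
    (2 ℕ.* suc m) !                                 ≡⟨ cong _! 2[1+m]≡2+2m ⟩
    (2 ℕ.+ 2 ℕ.* m) !                               ≡⟨ cong (λ j → suc (suc (2 ℕ.* m)) ℕ.* (suc (2 ℕ.* m) ℕ.* j)) (nCk*k!*[n∸k]!≡n! (ℕₚ.m≤n*m m 2)) ⟨
    (2 ℕ.+ 2 ℕ.* m) ℕ.* ((1 ℕ.+ 2 ℕ.* m) ℕ.* (c ℕ.* (m ! ℕ.* (2 ℕ.* m ∸ m) !)))
                                                    ≡⟨ cong (λ j → (2 ℕ.+ 2 ℕ.* m) ℕ.* ((1 ℕ.+ 2 ℕ.* m) ℕ.* (c ℕ.* (m ! ℕ.* j !)))) (2n∸n≡n m) ⟩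
    (2 ℕ.+ 2 ℕ.* m) ℕ.* ((1 ℕ.+ 2 ℕ.* m) ℕ.* (c ℕ.* (m ! ℕ.* m !)))
                                                    ≡⟨ collect m c (m !) ⟩
    2 ℕ.* (2 ℕ.* m ℕ.+ 1) ℕ.* c ℕ.* (suc m ℕ.* (m ! ℕ.* m !)) ∎)
    where
    open ≡-Reasoning
    c′ = 2 ℕ.* suc m C suc m
    c  = 2 ℕ.* m C m
    m+1*m!*m!≢0 : NonZero (suc m ℕ.* (m ! ℕ.* m !))
    m+1*m!*m!≢0 = ℕₚ.m*n≢0 (suc m) _ {{_}} {{m ℕₚ.!* m !≢0}}
    regroup : ∀ a c f → a ℕ.* c ℕ.* (a ℕ.* (f ℕ.* f)) ≡ c ℕ.* ((a ℕ.* f) ℕ.* (a ℕ.* f))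
    regroup = ℕ-solve-∀
    collect : ∀ m c f → (2 ℕ.+ 2 ℕ.* m) ℕ.* ((1 ℕ.+ 2 ℕ.* m) ℕ.* (c ℕ.* (f ℕ.* f)))
                        ≡ 2 ℕ.* (2 ℕ.* m ℕ.+ 1) ℕ.* c ℕ.* (suc m ℕ.* (f ℕ.* f))
    collect = ℕ-solve-∀
    2n∸n≡n : ∀ n → 2 ℕ.* n ∸ n ≡ n
    2n∸n≡n n = trans (cong (λ j → n ℕ.+ j ∸ n) (ℕₚ.+-identityʳ n)) (ℕₚ.m+n∸m≡n n n)
    2[1+m]≡2+2m : 2 ℕ.* suc m ≡ 2 ℕ.+ 2 ℕ.* m
    2[1+m]≡2+2m = ℕₚ.*-distribˡ-+ 2 1 m

  catalan-suc : ∀ m → (ℕtoℚ 2 + ℕtoℚ m) * catalan (suc m) ≡ (ℕtoℚ 2 + ℕtoℚ 4 * ℕtoℚ m) * catalan m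
  catalan-suc m = *-cancelʳ-≡ (ℕtoℚ (suc m)) (ℕtoℚ-nonZero (suc m)) (begin
    (ℕtoℚ 2 + ℕtoℚ m) * catalan (suc m) * ℕtoℚ (suc m)  ≡⟨ cong (λ q → q * catalan (suc m) * ℕtoℚ (suc m)) (ℕtoℚ-homo-+ 2 m) ⟨
    ℕtoℚ (2 ℕ.+ m) * catalan (suc m) * ℕtoℚ (suc m)     ≡⟨ rotate (ℕtoℚ (2 ℕ.+ m)) (catalan (suc m)) (ℕtoℚ (suc m)) ⟩
    ℕtoℚ (suc m) * (catalan (suc m) * ℕtoℚ (2 ℕ.+ m))   ≡⟨ cong (ℕtoℚ (suc m) *_) (/-*-ℕtoℚ (2 ℕ.* suc m C suc m) (2 ℕ.+ m)) ⟩
    ℕtoℚ (suc m) * ℕtoℚ (2 ℕ.* suc m C suc m)           ≡⟨ ℕtoℚ-homo-* (suc m) (2 ℕ.* suc m C suc m) ⟨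
    ℕtoℚ (suc m ℕ.* (2 ℕ.* suc m C suc m))              ≡⟨ cong ℕtoℚ (central-binomial-suc m) ⟩
    ℕtoℚ (2 ℕ.* (2 ℕ.* m ℕ.+ 1) ℕ.* (2 ℕ.* m C m))      ≡⟨ ℕtoℚ-homo-* (2 ℕ.* (2 ℕ.* m ℕ.+ 1)) (2 ℕ.* m C m) ⟩
    ℕtoℚ (2 ℕ.* (2 ℕ.* m ℕ.+ 1)) * ℕtoℚ (2 ℕ.* m C m)   ≡⟨ cong₂ _*_ (sym 2[2m+1]≡2+4m) (/-*-ℕtoℚ (2 ℕ.* m C m) (suc m)) ⟨
    (ℕtoℚ 2 + ℕtoℚ 4 * ℕtoℚ m) * (catalan m * ℕtoℚ (suc m)) ≡⟨ *-assoc (ℕtoℚ 2 + ℕtoℚ 4 * ℕtoℚ m) (catalan m) (ℕtoℚ (suc m)) ⟨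
    (ℕtoℚ 2 + ℕtoℚ 4 * ℕtoℚ m) * catalan m * ℕtoℚ (suc m) ∎)
    where
    open ≡-Reasoning
    rotate : ∀ a b c → a * b * c ≡ c * (b * a)
    rotate = solve-∀ ℚ-ring
    expand : ∀ m → 2 ℕ.* (2 ℕ.* m ℕ.+ 1) ≡ 2 ℕ.+ 4 ℕ.* m
    expand = ℕ-solve-∀
    2[2m+1]≡2+4m : ℕtoℚ (2 ℕ.* (2 ℕ.* m ℕ.+ 1)) ≡ ℕtoℚ 2 + ℕtoℚ 4 * ℕtoℚ m
    2[2m+1]≡2+4m = begin
      ℕtoℚ (2 ℕ.* (2 ℕ.* m ℕ.+ 1))  ≡⟨ cong ℕtoℚ (expand m) ⟩
      ℕtoℚ (2 ℕ.+ 4 ℕ.* m)          ≡⟨ ℕtoℚ-homo-+ 2 (4 ℕ.* m) ⟩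
      ℕtoℚ 2 + ℕtoℚ (4 ℕ.* m)       ≡⟨ cong (ℕtoℚ 2 +_) (ℕtoℚ-homo-* 4 m) ⟩
      ℕtoℚ 2 + ℕtoℚ 4 * ℕtoℚ m      ∎

  catalan-suc-suc : ∀ m → (ℕtoℚ 2 + ℕtoℚ m) * (ℕtoℚ 3 + ℕtoℚ m) * catalan (2 ℕ.+ m)
                          ≡ (ℕtoℚ 6 + ℕtoℚ 4 * ℕtoℚ m) * (ℕtoℚ 2 + ℕtoℚ 4 * ℕtoℚ m) * catalan m
  catalan-suc-suc m = begin
    (ℕtoℚ 2 + z) * (ℕtoℚ 3 + z) * catalan (2 ℕ.+ m)
      ≡⟨ regroup₁ (ℕtoℚ 2 + z) z (catalan (2 ℕ.+ m)) ⟩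
    (ℕtoℚ 2 + z) * ((ℕtoℚ 2 + (1ℚ + z)) * catalan (2 ℕ.+ m))
      ≡⟨ cong (λ w → (ℕtoℚ 2 + z) * ((ℕtoℚ 2 + w) * catalan (2 ℕ.+ m))) (ℕtoℚ-suc m) ⟨
    (ℕtoℚ 2 + z) * ((ℕtoℚ 2 + ℕtoℚ (suc m)) * catalan (2 ℕ.+ m))
      ≡⟨ cong ((ℕtoℚ 2 + z) *_) (catalan-suc (suc m)) ⟩
    (ℕtoℚ 2 + z) * ((ℕtoℚ 2 + ℕtoℚ 4 * ℕtoℚ (suc m)) * catalan (suc m))
      ≡⟨ cong (λ w → (ℕtoℚ 2 + z) * ((ℕtoℚ 2 + ℕtoℚ 4 * w) * catalan (suc m))) (ℕtoℚ-suc m) ⟩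
    (ℕtoℚ 2 + z) * ((ℕtoℚ 2 + ℕtoℚ 4 * (1ℚ + z)) * catalan (suc m))
      ≡⟨ regroup₂ z (catalan (suc m)) ⟩
    (ℕtoℚ 6 + ℕtoℚ 4 * z) * ((ℕtoℚ 2 + z) * catalan (suc m))
      ≡⟨ cong ((ℕtoℚ 6 + ℕtoℚ 4 * z) *_) (catalan-suc m) ⟩
    (ℕtoℚ 6 + ℕtoℚ 4 * z) * ((ℕtoℚ 2 + ℕtoℚ 4 * z) * catalan m)
      ≡⟨ *-assoc (ℕtoℚ 6 + ℕtoℚ 4 * z) (ℕtoℚ 2 + ℕtoℚ 4 * z) (catalan m) ⟨
    (ℕtoℚ 6 + ℕtoℚ 4 * z) * (ℕtoℚ 2 + ℕtoℚ 4 * z) * catalan m ∎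
    where
    open ≡-Reasoning
    z = ℕtoℚ m
    regroup₁ : ∀ a z c → a * (ℕtoℚ 3 + z) * c ≡ a * ((ℕtoℚ 2 + (1ℚ + z)) * c)
    regroup₁ = solve-∀ ℚ-ring
    regroup₂ : ∀ z c → (ℕtoℚ 2 + z) * ((ℕtoℚ 2 + ℕtoℚ 4 * (1ℚ + z)) * c) ≡ (ℕtoℚ 6 + ℕtoℚ 4 * z) * ((ℕtoℚ 2 + z) * c)
    regroup₂ = solve-∀ ℚ-ring

  2[1+h]+1≡2+[2h+1] : ∀ h → 2 ℕ.* suc h ℕ.+ 1 ≡ 2 ℕ.+ (2 ℕ.* h ℕ.+ 1)
  2[1+h]+1≡2+[2h+1] = ℕ-solve-∀

  catalan-odd-recurrence : ∀ h → leading h * catalan (2 ℕ.* suc h ℕ.+ 1) ≡ (ℕtoℚ 4 * trailing h) * catalan (2 ℕ.* h ℕ.+ 1)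
  catalan-odd-recurrence h = begin
    leading h * catalan (2 ℕ.* suc h ℕ.+ 1)                   ≡⟨ cong (λ m → leading h * catalan m) (2[1+h]+1≡2+[2h+1] h) ⟩
    leading h * catalan (2 ℕ.+ e)                              ≡⟨ cong (_* catalan (2 ℕ.+ e)) leading≡ ⟨
    (ℕtoℚ 2 + z) * (ℕtoℚ 3 + z) * catalan (2 ℕ.+ e)            ≡⟨ catalan-suc-suc e ⟩
    (ℕtoℚ 6 + ℕtoℚ 4 * z) * (ℕtoℚ 2 + ℕtoℚ 4 * z) * catalan e  ≡⟨ cong (_* catalan e) trailing≡ ⟩
    ℕtoℚ 4 * trailing h * catalan e                            ∎
    where
    open ≡-Reasoning
    e = 2 ℕ.* h ℕ.+ 1
    y = ℕtoℚ h
    z = ℕtoℚ e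
    z≡2y+1 : z ≡ ℕtoℚ 2 * y + 1ℚ
    z≡2y+1 = trans (ℕtoℚ-homo-+ (2 ℕ.* h) 1) (cong (_+ 1ℚ) (ℕtoℚ-homo-* 2 h))
    even-factors : ∀ y → (ℕtoℚ 2 + (ℕtoℚ 2 * y + 1ℚ)) * (ℕtoℚ 3 + (ℕtoℚ 2 * y + 1ℚ))
                         ≡ (ℕtoℚ 2 + y) * (ℕtoℚ 6 + ℕtoℚ 4 * y)
    even-factors = solve-∀ ℚ-ring
    odd-factors : ∀ y → (ℕtoℚ 6 + ℕtoℚ 4 * (ℕtoℚ 2 * y + 1ℚ)) * (ℕtoℚ 2 + ℕtoℚ 4 * (ℕtoℚ 2 * y + 1ℚ))
                        ≡ ℕtoℚ 4 * ((ℕtoℚ 3 + ℕtoℚ 4 * y) * (ℕtoℚ 5 + ℕtoℚ 4 * y))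
    odd-factors = solve-∀ ℚ-ring
    leading≡ : (ℕtoℚ 2 + z) * (ℕtoℚ 3 + z) ≡ leading h
    leading≡ = trans (cong (λ x → (ℕtoℚ 2 + x) * (ℕtoℚ 3 + x)) z≡2y+1) (even-factors y)
    trailing≡ : (ℕtoℚ 6 + ℕtoℚ 4 * z) * (ℕtoℚ 2 + ℕtoℚ 4 * z) ≡ ℕtoℚ 4 * trailing h
    trailing≡ = trans (cong (λ x → (ℕtoℚ 6 + ℕtoℚ 4 * x) * (ℕtoℚ 2 + ℕtoℚ 4 * x)) z≡2y+1) (odd-factors y)

  scaled-β-recurrence : ∀ h → leading h * (ℕtoℚ 2 ^ℚ (2 ℕ.* suc h ℕ.+ 1) * β (2 ℕ.+ h))
                              ≡ (ℕtoℚ 4 * trailing h) * (ℕtoℚ 2 ^ℚ (2 ℕ.* h ℕ.+ 1) * β (suc h))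
  scaled-β-recurrence h = begin
    leading h * (ℕtoℚ 2 ^ℚ (2 ℕ.* suc h ℕ.+ 1) * β (2 ℕ.+ h))
      ≡⟨ cong (λ m → leading h * (ℕtoℚ 2 ^ℚ m * β (2 ℕ.+ h))) (2[1+h]+1≡2+[2h+1] h) ⟩
    leading h * (ℕtoℚ 2 * (ℕtoℚ 2 * p) * β (2 ℕ.+ h)) ≡⟨ regroup₁ (leading h) p (β (2 ℕ.+ h)) ⟩
    ℕtoℚ 4 * p * (leading h * β (2 ℕ.+ h))           ≡⟨ cong (ℕtoℚ 4 * p *_) (β-recurrence h) ⟩
    ℕtoℚ 4 * p * (trailing h * β (suc h))            ≡⟨ regroup₂ p (trailing h) (β (suc h)) ⟩
    ℕtoℚ 4 * trailing h * (p * β (suc h))            ∎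
    where
    open ≡-Reasoning
    p = ℕtoℚ 2 ^ℚ (2 ℕ.* h ℕ.+ 1)
    regroup₁ : ∀ k p b → k * (ℕtoℚ 2 * (ℕtoℚ 2 * p) * b) ≡ ℕtoℚ 4 * p * (k * b)
    regroup₁ = solve-∀ ℚ-ring
    regroup₂ : ∀ p t b → ℕtoℚ 4 * p * (t * b) ≡ ℕtoℚ 4 * t * (p * b)
    regroup₂ = solve-∀ ℚ-ring

  first-order-recurrence-unique : ∀ (p q a b : ℕ → ℚ) → (∀ h → p h ≢ 0ℚ) →
    (∀ h → p h * a (suc h) ≡ q h * a h) → (∀ h → p h * b (suc h) ≡ q h * b h) → a 0 ≡ b 0 → ∀ h → a h ≡ b h
  first-order-recurrence-unique p q a b p≢0 a-rec b-rec a₀≡b₀ zero    = a₀≡b₀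
  first-order-recurrence-unique p q a b p≢0 a-rec b-rec a₀≡b₀ (suc h) = *-cancelʳ-≡ (p h) (p≢0 h) (begin
    a (suc h) * p h  ≡⟨ *-comm (a (suc h)) (p h) ⟩
    p h * a (suc h)  ≡⟨ a-rec h ⟩
    q h * a h        ≡⟨ cong (q h *_) (first-order-recurrence-unique p q a b p≢0 a-rec b-rec a₀≡b₀ h) ⟩
    q h * b h        ≡⟨ b-rec h ⟨
    p h * b (suc h)  ≡⟨ *-comm (p h) (b (suc h)) ⟩
    b (suc h) * p h  ∎)
    where open ≡-Reasoning

  β-catalan : ∀ h → ℕtoℚ 2 ^ℚ (2 ℕ.* h ℕ.+ 1) * β (suc h) ≡ catalan (2 ℕ.* h ℕ.+ 1)
  β-catalan = first-order-recurrence-unique leading (λ h → ℕtoℚ 4 * trailing h)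
    (λ h → ℕtoℚ 2 ^ℚ (2 ℕ.* h ℕ.+ 1) * β (suc h)) (λ h → catalan (2 ℕ.* h ℕ.+ 1))
    leading≢0 scaled-β-recurrence catalan-odd-recurrence refl

  2[1+h]∸1≡2h+1 : ∀ h → 2 ℕ.* suc h ∸ 1 ≡ 2 ℕ.* h ℕ.+ 1
  2[1+h]∸1≡2h+1 h = trans (cong (_∸ 1) (ℕₚ.*-suc 2 h)) (ℕₚ.+-comm 1 (2 ℕ.* h))

open import Defs
open import Data.Nat using (ℕ; suc; _≥_; _∸_; _*_)
open import Data.Rational using (ℚ) renaming (_*_ to _*ℚ_)
open import Relation.Binary.PropositionalEquality using (_≡_)
open BetaCatalan using (β-catalan; 2[1+h]∸1≡2h+1)

proposition2 : (g : ℕ) → g ≥ 1 → (ℕtoℚ 2 ^ℚ (2 * g ∸ 1)) *ℚ β g ≡ catalan (2 * g ∸ 1)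
proposition2 (suc h) _ rewrite 2[1+h]∸1≡2h+1 h = β-catalan h
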